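{- For a finite simple graph $G$ the following are equivalent: (i) $G$ is a hereditary unigraph; (ii) $G$ contains none of the configurations (a), (b), (c), (d) described below; (iii) $G$ is $\mathcal{F}$-free, where $\mathcal{F}$ is the set of sixteen graphs described below.
   Context: All graphs are finite and simple. A unigraph is a graph $G$ such that every graph with the same degree sequence as $G$ is isomorphic to $G$; a hereditary unigraph is a graph all of whose induced subgraphs are unigraphs. A graph is $\mathcal{F}$-free if none of its induced subgraphs is isomorphic to a member of $\mathcal{F}$. A configuration is a triple $(V,E,F)$ with $(V,E)$ a graph and $F$ a set of vertex pairs not in $E$ (non-edges); $G$ contains it if there is an injection $f:V\to V(G)$ with $f(x)f(y)\in E(G)$ for all $xy\in E$ and $f(x)f(y)\notin E(G)$ for all $xy\in F$ (other pairs unconstrained). The configurations are: (a) vertices $p,q,r,s,w$; edges $pq,rs,qw,rw$; non-edges $qr,ps,pw,sw$. (b) vertices $p,q,r,s,w$; edges $pq,rs,pw,qw$; non-edges $qr,ps,rw,sw$. (c) vertices $p,q,r,s,y,z$; edges $pq,rs,pz,qy$; non-edges $qr,ps,rz,sy$. (d) vertices $p,q,r,s,y,z$; edges $pq,rs,ry,qz$; non-edges $qr,ps,py,sz$. The set $\mathcal{F}$ consists of: $P_5$; the house $\overline{P_5}$ (a 4-cycle plus a vertex adjacent to two adjacent cycle vertices); $K_2+K_3$; $K_{2,3}$; the 4-pan (a 4-cycle with a pendant vertex attached to one cycle vertex); the co-4-pan (its complement); $2P_3$; $(K_2+K_1)\vee(K_2+K_1)$; $K_2+P_4$; $2K_1\vee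 P_4$; $K_2+C_4$; $2K_1\vee 2K_2$; the graph $X_1$ on vertices $p,q,r,s,t,u$ with edge set $\{pq,pr,pt,pu,qu,ru,rs\}$; the graph $X_2$ obtained from $X_1$ by adding the edge $tu$; and the complements $\overline{X_1}$, $\overline{X_2}$. Here $+$ denotes disjoint union, $\vee$ denotes join, and $kH$ denotes $k$ disjoint copies of $H$. -}

module Defs where

open import Data.Nat using (ℕ; zero; suc)
open import Data.Fin using (Fin; zero; suc; _≟_)
open import Data.Bool using (Bool; true; false; _∧_; _∨_; not; if_then_else_)
open import Data.Bool.Properties using (∨-comm)
open import Data.List using (List; []; _∷_; map; allFin)
open import Data.Nat.ListAction using (sum)
open import Data.List.Relation.Unary.All using (All)
open import Data.List.Relation.Binary.Permutation.Propositional using (_↭_)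
open import Data.Product using (Σ; _×_; _,_)
open import Relation.Binary.PropositionalEquality using (_≡_; refl; sym)
open import Relation.Nullary using (yes; no; ¬_)
open import Relation.Nullary.Decidable using (⌊_⌋)
import Data.Empty
open import Function.Bundles using (_↔_; Inverse)
open import Function.Definitions using (Injective)

record Graph : Set where
  field
    n     : ℕ
    adj   : Fin n → Fin n → Bool
    adj-sym  : ∀ i j → adj i j ≡ adj j i
    adj-irr  : ∀ i → adj i i ≡ false
open Graph public

_≅_ : Graph → Graph → Set
G ≅ H = Σ (Fin (n G) ↔ Fin (n H)) λ f →
  ∀ i j → adj G i j ≡ adj H (Inverse.to f i) (Inverse.to f j)

-- Degree of a vertex and degree sequence (as a list; two graphs have the
-- same degree sequence iff these lists are permutations of each other).
deg : (G : Graph) → Fin (n G) → ℕ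
deg G v = sum (map (λ u → if adj G v u then 1 else 0) (allFin (n G)))

degSeq : Graph → List ℕ
degSeq G = map (deg G) (allFin (n G))

SameDegSeq : Graph → Graph → Set
SameDegSeq G H = degSeq G ↭ degSeq H

Unigraph : Graph → Set
Unigraph G = ∀ (H : Graph) → SameDegSeq G H → G ≅ H

induced : (G : Graph) (k : ℕ) (f : Fin k → Fin (n G)) → Graph
induced G k f = record
  { n = k
  ; adj = λ i j → adj G (f i) (f j)
  ; adj-sym = λ i j → adj-sym G (f i) (f j)
  ; adj-irr = λ i → adj-irr G (f i)
  }

HereditaryUnigraph : Graph → Set
HereditaryUnigraph G =
  ∀ (k : ℕ) (f : Fin k → Fin (n G)) → Injective _≡_ _≡_ f →
  Unigraph (induced G k f)

ContainsInduced : Graph → Graph → Set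
ContainsInduced G H = Σ (Fin (n H) → Fin (n G)) λ f →
  Injective _≡_ _≡_ f × (∀ i j → adj H i j ≡ adj G (f i) (f j))

Free : List Graph → Graph → Set
Free Fs G = All (λ H → ¬ ContainsInduced G H) Fs

private
  memOrd : ∀ {k} → List (Fin k × Fin k) → Fin k → Fin k → Bool
  memOrd [] i j = false
  memOrd ((a , b) ∷ es) i j = (⌊ a ≟ i ⌋ ∧ ⌊ b ≟ j ⌋) ∨ memOrd es i j

  adjE : ∀ {k} → List (Fin k × Fin k) → Fin k → Fin k → Bool
  adjE es i j with i ≟ j
  ... | yes _ = false
  ... | no _  = memOrd es i j ∨ memOrd es j i

  adjE-sym : ∀ {k} (es : List (Fin k × Fin k)) i j → adjE es i j ≡ adjE es j i
  adjE-sym es i j with i ≟ j | j ≟ i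
  ... | yes _ | yes _ = refl
  ... | yes p | no q  = ⊥-elim′ (q (sym p))
    where ⊥-elim′ : ∀ {A : Set} → Data.Empty.⊥ → A
          ⊥-elim′ ()
  ... | no q  | yes p = ⊥-elim′ (q (sym p))
    where ⊥-elim′ : ∀ {A : Set} → Data.Empty.⊥ → A
          ⊥-elim′ ()
  ... | no _  | no _  = ∨-comm (memOrd es i j) (memOrd es j i)

  adjE-irr : ∀ {k} (es : List (Fin k × Fin k)) i → adjE es i i ≡ false
  adjE-irr es i with i ≟ i
  ... | yes _ = refl
  ... | no q  = ⊥-elim′ (q refl)
    where ⊥-elim′ : ∀ {A : Set} → Data.Empty.⊥ → A
          ⊥-elim′ ()

fromEdges : (k : ℕ) → List (Fin k × Fin k) → Graph
fromEdges k es = record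
  { n = k ; adj = adjE es ; adj-sym = adjE-sym es ; adj-irr = adjE-irr es }

complement : Graph → Graph
complement G = record
  { n = n G
  ; adj = λ i j → if ⌊ i ≟ j ⌋ then false else not (adj G i j)
  ; adj-sym = csym
  ; adj-irr = cirr
  }
  where
    csym : ∀ i j → (if ⌊ i ≟ j ⌋ then false else not (adj G i j))
                 ≡ (if ⌊ j ≟ i ⌋ then false else not (adj G j i))
    csym i j with i ≟ j | j ≟ i
    ... | yes _ | yes _ = refl
    ... | yes p | no q  = ⊥-elim′ (q (sym p))
      where ⊥-elim′ : ∀ {A : Set} → Data.Empty.⊥ → A
            ⊥-elim′ ()
    ... | no q  | yes p = ⊥-elim′ (q (sym p))
      where ⊥-elim′ : ∀ {A : Set} → Data.Empty.⊥ → A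
            ⊥-elim′ ()
    ... | no _  | no _  rewrite adj-sym G i j = refl
    cirr : ∀ i → (if ⌊ i ≟ i ⌋ then false else not (adj G i i)) ≡ false
    cirr i with i ≟ i
    ... | yes _ = refl
    ... | no q  = ⊥-elim′ (q refl)
      where ⊥-elim′ : ∀ {A : Set} → Data.Empty.⊥ → A
            ⊥-elim′ ()

-- Configurations (V, E, F): V = Fin k, E edges, F required non-edges.

record Configuration : Set where
  field
    k        : ℕ
    edges    : List (Fin k × Fin k)
    nonedges : List (Fin k × Fin k)
open Configuration public

ContainsConfig : Graph → Configuration → Set
ContainsConfig G C = Σ (Fin (k C) → Fin (n G)) λ f →
  Injective _≡_ _≡_ f ×
  All (λ e → adj G (f (Data.Product.proj₁ e)) (f (Data.Product.proj₂ e)) ≡ true) (edges C) ×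
  All (λ e → adj G (f (Data.Product.proj₁ e)) (f (Data.Product.proj₂ e)) ≡ false) (nonedges C)

private
  v0 v1 v2 v3 v4 : ∀ {m} → Fin (suc (suc (suc (suc (suc m))))) 
  v0 = zero
  v1 = suc zero
  v2 = suc (suc zero)
  v3 = suc (suc (suc zero))
  v4 = suc (suc (suc (suc zero)))
  v5 : ∀ {m} → Fin (suc (suc (suc (suc (suc (suc m))))))
  v5 = suc (suc (suc (suc (suc zero))))

-- (a): p,q,r,s,w = 0,1,2,3,4; edges pq,rs,qw,rw; non-edges qr,ps,pw,sw.
confA : Configuration
confA = record { k = 5
  ; edges    = (v0 , v1) ∷ (v2 , v3) ∷ (v1 , v4) ∷ (v2 , v4) ∷ []
  ; nonedges = (v1 , v2) ∷ (v0 , v3) ∷ (v0 , v4) ∷ (v3 , v4) ∷ [] }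

-- (b): p,q,r,s,w = 0..4; edges pq,rs,pw,qw; non-edges qr,ps,rw,sw.
confB : Configuration
confB = record { k = 5
  ; edges    = (v0 , v1) ∷ (v2 , v3) ∷ (v0 , v4) ∷ (v1 , v4) ∷ []
  ; nonedges = (v1 , v2) ∷ (v0 , v3) ∷ (v2 , v4) ∷ (v3 , v4) ∷ [] }

-- (c): p,q,r,s,y,z = 0..5; edges pq,rs,pz,qy; non-edges qr,ps,rz,sy.
confC : Configuration
confC = record { k = 6
  ; edges    = (v0 , v1) ∷ (v2 , v3) ∷ (v0 , v5) ∷ (v1 , v4) ∷ []
  ; nonedges = (v1 , v2) ∷ (v0 , v3) ∷ (v2 , v5) ∷ (v3 , v4) ∷ [] }

-- (d): p,q,r,s,y,z = 0..5; edges pq,rs,ry,qz; non-edges qr,ps,py,sz.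
confD : Configuration
confD = record { k = 6
  ; edges    = (v0 , v1) ∷ (v2 , v3) ∷ (v2 , v4) ∷ (v1 , v5) ∷ []
  ; nonedges = (v1 , v2) ∷ (v0 , v3) ∷ (v0 , v4) ∷ (v3 , v5) ∷ [] }

NoConfigurations : Graph → Set
NoConfigurations G =
  ¬ ContainsConfig G confA × ¬ ContainsConfig G confB ×
  ¬ ContainsConfig G confC × ¬ ContainsConfig G confD

P5 : Graph
P5 = fromEdges 5 ((v0 , v1) ∷ (v1 , v2) ∷ (v2 , v3) ∷ (v3 , v4) ∷ [])

house : Graph
house = fromEdges 5 ((v0 , v1) ∷ (v1 , v2) ∷ (v2 , v3) ∷ (v3 , v0) ∷
                     (v4 , v0) ∷ (v4 , v1) ∷ [])

K2+K3 : Graph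
K2+K3 = fromEdges 5 ((v0 , v1) ∷ (v2 , v3) ∷ (v3 , v4) ∷ (v2 , v4) ∷ [])

K23 : Graph
K23 = fromEdges 5 ((v0 , v2) ∷ (v0 , v3) ∷ (v0 , v4) ∷
                   (v1 , v2) ∷ (v1 , v3) ∷ (v1 , v4) ∷ [])

pan4 : Graph
pan4 = fromEdges 5 ((v0 , v1) ∷ (v1 , v2) ∷ (v2 , v3) ∷ (v3 , v0) ∷
                    (v4 , v0) ∷ [])

copan4 : Graph
copan4 = complement pan4

twoP3 : Graph
twoP3 = fromEdges 6 ((v0 , v1) ∷ (v1 , v2) ∷ (v3 , v4) ∷ (v4 , v5) ∷ [])

K2K1joinK2K1 : Graph
K2K1joinK2K1 = fromEdges 6 ((v0 , v1) ∷ (v3 , v4) ∷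
  (v0 , v3) ∷ (v0 , v4) ∷ (v0 , v5) ∷
  (v1 , v3) ∷ (v1 , v4) ∷ (v1 , v5) ∷
  (v2 , v3) ∷ (v2 , v4) ∷ (v2 , v5) ∷ [])

K2+P4 : Graph
K2+P4 = fromEdges 6 ((v0 , v1) ∷ (v2 , v3) ∷ (v3 , v4) ∷ (v4 , v5) ∷ [])

twoK1joinP4 : Graph
twoK1joinP4 = fromEdges 6 ((v2 , v3) ∷ (v3 , v4) ∷ (v4 , v5) ∷
  (v0 , v2) ∷ (v0 , v3) ∷ (v0 , v4) ∷ (v0 , v5) ∷
  (v1 , v2) ∷ (v1 , v3) ∷ (v1 , v4) ∷ (v1 , v5) ∷ [])

K2+C4 : Graph
K2+C4 = fromEdges 6 ((v0 , v1) ∷ (v2 , v3) ∷ (v3 , v4) ∷ (v4 , v5) ∷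
                     (v5 , v2) ∷ [])

twoK1join2K2 : Graph
twoK1join2K2 = fromEdges 6 ((v2 , v3) ∷ (v4 , v5) ∷
  (v0 , v2) ∷ (v0 , v3) ∷ (v0 , v4) ∷ (v0 , v5) ∷
  (v1 , v2) ∷ (v1 , v3) ∷ (v1 , v4) ∷ (v1 , v5) ∷ [])

-- X1: p,q,r,s,t,u = 0..5; edges pq,pr,pt,pu,qu,ru,rs
X1 : Graph
X1 = fromEdges 6 ((v0 , v1) ∷ (v0 , v2) ∷ (v0 , v4) ∷ (v0 , v5) ∷
                  (v1 , v5) ∷ (v2 , v5) ∷ (v2 , v3) ∷ [])

X2 : Graph
X2 = fromEdges 6 ((v0 , v1) ∷ (v0 , v2) ∷ (v0 , v4) ∷ (v0 , v5) ∷
                  (v1 , v5) ∷ (v2 , v5) ∷ (v2 , v3) ∷ (v4 , v5) ∷ [])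

𝓕 : List Graph
𝓕 = P5 ∷ house ∷ K2+K3 ∷ K23 ∷ pan4 ∷ copan4 ∷ twoP3 ∷ K2K1joinK2K1 ∷
    K2+P4 ∷ twoK1joinP4 ∷ K2+C4 ∷ twoK1join2K2 ∷
    X1 ∷ X2 ∷ complement X1 ∷ complement X2 ∷ []

-- The heart is (ii) ⇒ (i). Two graphs on the same vertex set with the same degrees are joined by
-- a sequence of 2-switches (pq, rs ↦ qr, ps), which can be chosen to fix the rows of the vertices
-- treated so far: if row w differs, degree counting produces a 2-switch of one of the two graphs
-- that repairs two entries of that row. Without the configurations (a)–(d) every 2-switch yields
-- an isomorphic graph: either p and r or q and s have the same neighbours outside {p, q, r, s},
-- since two vertices telling both pairs apart would complete one of the configurations, and
-- exchanging such twins realises the switch. The other implications are finite checks: every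
-- member of 𝓕 contains a configuration ((ii) ⇒ (iii)) and has a non-isomorphic graph with the same
-- degree sequence ((i) ⇒ (iii)), and every completion of a configuration to a graph on its
-- vertices contains a member of 𝓕 ((iii) ⇒ (ii)).

module Submission where

open import Defs
import Data.Nat.Properties as ℕₚ
open import Algebra.Properties.CommutativeMonoid.Sum ℕₚ.+-0-commutativeMonoid
  using (sum; sum-cong-≗; sum-replicate-zero; ∑-distrib-+; ∑-permute)
open import Data.Bool using (Bool; true; false; not; _∧_; _∨_; _xor_; if_then_else_)
import Data.Bool.Properties as Boolₚ
open Boolₚ using (¬-not)
open import Data.Empty using (⊥; ⊥-elim)
open import Data.Fin using (Fin; zero; suc; _≟_; toℕ; fromℕ<; cast; #_)
open import Data.Fin.Patterns
import Data.Fin.Properties as Finₚ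
open import Data.Fin.Permutation as Perm using (Permutation; _⟨$⟩ʳ_; _∘ₚ_)
import Data.Fin.Permutation.Components as PC
open import Data.List using (List; []; _∷_; _++_; map; tabulate; allFin; length; lookup)
import Data.List.Properties as Listₚ
open import Data.List.Membership.Propositional.Properties using (∈-lookup)
open import Data.List.Relation.Binary.Permutation.Propositional using (↭-reflexive; ↭⇒↭ₛ)
import Data.List.Relation.Binary.Permutation.Setoid as Permₛ
import Data.List.Relation.Binary.Permutation.Setoid.Properties as Permₛₚ
open import Data.List.Relation.Unary.All as All using (All; []; _∷_)
import Data.List.Relation.Unary.All.Properties as Allₚ
open import Data.List.Relation.Unary.Any as Any using (Any; here; there)
open import Data.Nat using (ℕ; zero; suc; _+_; _≤_; _<_; z≤n; s≤s)
open import Data.Nat.Induction using (<-rec)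
open import Data.Nat.ListAction using () renaming (sum to sumList)
open import Data.Product using (Σ; ∃; _×_; _,_; proj₁; proj₂)
open import Data.Sum as Sum using (_⊎_; inj₁; inj₂)
open import Data.Vec as Vec using (Vec; []; _∷_)
import Data.Vec.Properties as Vecₚ
import Data.Vec.Relation.Unary.All as VAll
open VAll using ([]; _∷_)
open import Data.Vec.Relation.Unary.AllPairs using ([]; _∷_; allPairs?)
open import Data.Vec.Relation.Unary.Unique.Propositional using (Unique)
import Data.Vec.Relation.Unary.Unique.Propositional.Properties as Uniqueₚ
open import Function.Base using (id; _∘_)
open import Function.Bundles using (Inverse; Injection; _⇔_; mk⇔)
open import Function.Construct.Composition using (_↔-∘_)
open import Function.Construct.Symmetry using (↔-sym)
open import Function.Definitions using (Injective)
open import Function.Properties.Inverse using (↔⇒↣)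
open import Relation.Binary.PropositionalEquality
  using (_≡_; _≢_; refl; sym; trans; cong; cong₂; subst; ≢-sym; setoid; module ≡-Reasoning)
open import Relation.Nullary using (¬_; Dec; yes; no; does; contradiction)
open import Relation.Nullary.Decidable
  using ( True; False; toWitness; toWitnessFalse; map′; dec-true; dec-false; decidable-stable
        ; ¬?; _×-dec_; _⊎-dec_)

≅-trans : ∀ G H K → G ≅ H → H ≅ K → G ≅ K
≅-trans G H K (f , f-adj) (g , g-adj) = g ↔-∘ f , λ i j → trans (f-adj i j) (g-adj _ _)

≅-sym : ∀ G H → G ≅ H → H ≅ G
≅-sym G H (f , f-adj) = ↔-sym f , λ i j → sym (trans (f-adj _ _)
  (cong₂ (adj H) (Inverse.strictlyInverseˡ f i) (Inverse.strictlyInverseˡ f j)))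

≅⇒contains : ∀ G H → G ≅ H → ContainsInduced H G
≅⇒contains G H (f , f-adj) = Inverse.to f , Injection.injective (↔⇒↣ f) , f-adj

contains-trans : ∀ G H K → ContainsInduced G H → ContainsInduced H K → ContainsInduced G K
contains-trans G H K (f , f-inj , f-adj) (g , g-inj , g-adj) =
  f ∘ g , g-inj ∘ f-inj , λ i j → trans (g-adj i j) (f-adj _ _)

contains-induced : ∀ G k f → Injective _≡_ _≡_ f → ContainsInduced G (induced G k f)
contains-induced G k f f-inj = f , f-inj , λ _ _ → refl

contains⇒containsConfig : ∀ G H C → ContainsInduced G H → ContainsConfig H C → ContainsConfig G C
contains⇒containsConfig G H C (f , f-inj , f-adj) (g , g-inj , on-edges , on-nonedges) =
  f ∘ g , g-inj ∘ f-inj , All.map transport on-edges , All.map transport on-nonedges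
  where
  transport : ∀ {b e} → adj H (g (proj₁ e)) (g (proj₂ e)) ≡ b →
    adj G (f (g (proj₁ e))) (f (g (proj₂ e))) ≡ b
  transport = trans (sym (f-adj _ _))

contains⇒noConfigurations : ∀ G H → ContainsInduced G H → NoConfigurations G → NoConfigurations H
contains⇒noConfigurations G H G⊇H (¬a , ¬b , ¬c , ¬d) = avoid ¬a , avoid ¬b , avoid ¬c , avoid ¬d
  where
  avoid : ∀ {C} → ¬ ContainsConfig G C → ¬ ContainsConfig H C
  avoid ¬C = ¬C ∘ contains⇒containsConfig G H _ G⊇H

lookup-injective : ∀ {m k} {v : Vec (Fin m) k} → Unique v → Injective _≡_ _≡_ (Vec.lookup v)
lookup-injective v! = Uniqueₚ.lookup-injective v! _ _

≅⇒noConfigurations : ∀ G H → G ≅ H → NoConfigurations G → NoConfigurations H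
≅⇒noConfigurations G H G≅H = contains⇒noConfigurations G H (≅⇒contains H G (≅-sym G H G≅H))

𝟙 : Bool → ℕ
𝟙 true  = 1
𝟙 false = 0

𝟙-mono : ∀ {b c} → ¬ (b ≡ true × c ≡ false) → 𝟙 b ≤ 𝟙 c
𝟙-mono {false} _  = z≤n
𝟙-mono {true} {true} _ = ℕₚ.≤-refl
𝟙-mono {true} {false} ¬bc = contradiction (refl , refl) ¬bc

δ : ∀ {m} → Fin m → ℕ → Fin m → ℕ
δ x c y = if does (y ≟ x) then c else 0

sum-δ : ∀ {m} (x : Fin m) c → sum (δ x c) ≡ c
sum-δ {suc m} zero    c = trans (cong (c +_) (sum-replicate-zero m)) (ℕₚ.+-identityʳ c)
sum-δ {suc m} (suc x) c = sum-δ x c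

sum-mono-≤ : ∀ {m} {f g : Fin m → ℕ} → (∀ i → f i ≤ g i) → sum f ≤ sum g
sum-mono-≤ {zero}  _   = z≤n
sum-mono-≤ {suc m} f≤g = ℕₚ.+-mono-≤ (f≤g zero) (sum-mono-≤ (f≤g ∘ suc))

transpose-ˡ : ∀ {m} (i j : Fin m) → PC.transpose i j i ≡ j
transpose-ˡ i j rewrite dec-true (i ≟ i) refl = refl

transpose-ʳ : ∀ {m} (i j : Fin m) → PC.transpose i j j ≡ i
transpose-ʳ i j with j ≟ i
... | yes refl = refl
... | no _ rewrite dec-true (j ≟ j) refl = refl

transpose-other : ∀ {m} {i j k : Fin m} → k ≢ i → k ≢ j → PC.transpose i j k ≡ k
transpose-other {i = i} {j} {k} k≢i k≢j rewrite dec-false (k ≟ i) k≢i | dec-false (k ≟ j) k≢j = refl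

sum-transpose : ∀ {m} (f : Fin m → ℕ) (i j : Fin m) → sum f ≡ sum (f ∘ PC.transpose i j)
sum-transpose f i j = ∑-permute f (Perm.transpose i j)

record GraphOn (m : ℕ) : Set where
  field
    edge     : Fin m → Fin m → Bool
    edge-sym : ∀ i j → edge i j ≡ edge j i
    edge-irr : ∀ i → edge i i ≡ false
open GraphOn public

graph : ∀ {m} → GraphOn m → Graph
graph {m} A = record { n = m ; adj = edge A ; adj-sym = edge-sym A ; adj-irr = edge-irr A }

onVertices : (G : Graph) → GraphOn (n G)
onVertices G = record { edge = adj G ; edge-sym = adj-sym G ; edge-irr = adj-irr G }

degree : ∀ {m} → GraphOn m → Fin m → ℕ
degree A v = sum (λ u → 𝟙 (edge A v u))

SameDegrees : ∀ {m} → GraphOn m → GraphOn m → Set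
SameDegrees A B = ∀ v → degree A v ≡ degree B v

deg≡degree : ∀ G v → deg G v ≡ degree (onVertices G) v
deg≡degree G v = begin
  sumList (map (λ u → if adj G v u then 1 else 0) (allFin (n G)))
    ≡⟨ cong sumList (Listₚ.map-tabulate (λ u → u) (λ u → if adj G v u then 1 else 0)) ⟩
  sumList (tabulate (λ u → if adj G v u then 1 else 0))
    ≡⟨ sumList-tabulate (λ u → if adj G v u then 1 else 0) ⟩
  sum (λ u → if adj G v u then 1 else 0)
    ≡⟨ sum-cong-≗ (λ u → if≡𝟙 (adj G v u)) ⟩
  degree (onVertices G) v ∎
  where
  open ≡-Reasoning
  sumList-tabulate : ∀ {k} (f : Fin k → ℕ) → sumList (tabulate f) ≡ sum f
  sumList-tabulate {zero}  f = refl
  sumList-tabulate {suc k} f = cong (f zero +_) (sumList-tabulate (f ∘ suc))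
  if≡𝟙 : ∀ b → (if b then 1 else 0) ≡ 𝟙 b
  if≡𝟙 true  = refl
  if≡𝟙 false = refl

≅-pointwise : ∀ {m} (A B : GraphOn m) → (∀ i j → edge A i j ≡ edge B i j) → graph A ≅ graph B
≅-pointwise A B same = Perm.id , same

relabel : ∀ {m} (H : Graph) → Permutation m (n H) → GraphOn m
relabel H π = record
  { edge     = λ i j → adj H (π ⟨$⟩ʳ i) (π ⟨$⟩ʳ j)
  ; edge-sym = λ i j → adj-sym H _ _
  ; edge-irr = λ i → adj-irr H _
  }

relabel-≅ : ∀ {m} (H : Graph) (π : Permutation m (n H)) → graph (relabel H π) ≅ H
relabel-≅ H π = π , λ _ _ → refl

degree-relabel : ∀ {m} (H : Graph) (π : Permutation m (n H)) v →
  degree (relabel H π) v ≡ degree (onVertices H) (π ⟨$⟩ʳ v)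
degree-relabel H π v = sym (∑-permute (λ u → 𝟙 (adj H (π ⟨$⟩ʳ v) u)) π)

-- Two-switches

SamePair : ∀ {m} → Fin m → Fin m → Fin m → Fin m → Set
SamePair i j x y = (i ≡ x × j ≡ y) ⊎ (i ≡ y × j ≡ x)

samePair? : ∀ {m} (i j x y : Fin m) → Dec (SamePair i j x y)
samePair? i j x y = (i ≟ x ×-dec j ≟ y) ⊎-dec (i ≟ y ×-dec j ≟ x)

samePair?-sym : ∀ {m} (i j x y : Fin m) → does (samePair? i j x y) ≡ does (samePair? j i x y)
samePair?-sym i j x y =
  trans (Boolₚ.∨-comm (i=x ∧ j=y) (i=y ∧ j=x)) (cong₂ _∨_ (Boolₚ.∧-comm i=y j=x) (Boolₚ.∧-comm i=x j=y))
  where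
  i=x = does (i ≟ x)
  j=y = does (j ≟ y)
  i=y = does (i ≟ y)
  j=x = does (j ≟ x)

samePair-comm : ∀ {m} {i j x y : Fin m} → SamePair i j x y → SamePair i j y x
samePair-comm = Sum.swap

¬samePair : ∀ {m} {i j x y : Fin m} → i ≢ x ⊎ j ≢ y → i ≢ y ⊎ j ≢ x → ¬ SamePair i j x y
¬samePair i≢x⊎j≢y _ (inj₁ (i≡x , j≡y)) = Sum.[ contradiction i≡x , contradiction j≡y ] i≢x⊎j≢y
¬samePair _ i≢y⊎j≢x (inj₂ (i≡y , j≡x)) = Sum.[ contradiction i≡y , contradiction j≡x ] i≢y⊎j≢x

Untouched : ∀ {m} (p q r s i j : Fin m) → Set
Untouched p q r s i j =
  ¬ SamePair i j p q × ¬ SamePair i j r s × ¬ SamePair i j q r × ¬ SamePair i j p s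

untouched-outside : ∀ {m} {p q r s i : Fin m} j →
  i ≢ p → i ≢ q → i ≢ r → i ≢ s → Untouched p q r s i j
untouched-outside _ i≢p i≢q i≢r i≢s =
  ¬samePair (inj₁ i≢p) (inj₁ i≢q) , ¬samePair (inj₁ i≢r) (inj₁ i≢s) ,
  ¬samePair (inj₁ i≢q) (inj₁ i≢r) , ¬samePair (inj₁ i≢p) (inj₁ i≢s)

true≢false : true ≢ false
true≢false ()

adjacent⇒≢ : ∀ {m} (A : GraphOn m) {x y} → edge A x y ≡ true → x ≢ y
adjacent⇒≢ A x~y refl = true≢false (trans (sym x~y) (edge-irr A _))

separated⇒≢ : ∀ {m} (A : GraphOn m) {x y z} → edge A x y ≡ true → edge A x z ≡ false → y ≢ z
separated⇒≢ A x~y x≁z refl = true≢false (trans (sym x~y) x≁z)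

flipped : ∀ {m} (A : GraphOn m) {x y b} → edge A x y ≡ b → edge A y x ≡ b
flipped A = trans (edge-sym A _ _)

record TwoSwitch {m} (A B : GraphOn m) (p q r s : Fin m) : Set where
  field
    A-pq : edge A p q ≡ true
    A-rs : edge A r s ≡ true
    A-qr : edge A q r ≡ false
    A-ps : edge A p s ≡ false
    B-pq : edge B p q ≡ false
    B-rs : edge B r s ≡ false
    B-qr : edge B q r ≡ true
    B-ps : edge B p s ≡ true
    unchanged : ∀ {i j} → Untouched p q r s i j → edge A i j ≡ edge B i j

  p≢q : p ≢ q
  p≢q = adjacent⇒≢ A A-pq
  r≢s : r ≢ s
  r≢s = adjacent⇒≢ A A-rs
  q≢r : q ≢ r
  q≢r = adjacent⇒≢ B B-qr
  p≢s : p ≢ s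
  p≢s = adjacent⇒≢ B B-ps
  p≢r : p ≢ r
  p≢r = separated⇒≢ A (flipped A A-pq) A-qr
  q≢s : q ≢ s
  q≢s = separated⇒≢ A A-pq A-ps

module _ {m} {A B : GraphOn m} {p q r s : Fin m} (sw : TwoSwitch A B p q r s) where
  open TwoSwitch sw

  swap-sides : TwoSwitch A B r s p q
  swap-sides = record
    { A-pq = A-rs ; A-rs = A-pq ; A-qr = flipped A A-ps ; A-ps = flipped A A-qr
    ; B-pq = B-rs ; B-rs = B-pq ; B-qr = flipped B B-ps ; B-ps = flipped B B-qr
    ; unchanged = λ (¬rs , ¬pq , ¬sp , ¬rq) →
        unchanged (¬pq , ¬rs , ¬rq ∘ samePair-comm , ¬sp ∘ samePair-comm)
    }

  swap-ends : TwoSwitch A B q p s r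
  swap-ends = record
    { A-pq = flipped A A-pq ; A-rs = flipped A A-rs ; A-qr = A-ps ; A-ps = A-qr
    ; B-pq = flipped B B-pq ; B-rs = flipped B B-rs ; B-qr = B-ps ; B-ps = B-qr
    ; unchanged = λ (¬qp , ¬sr , ¬ps , ¬qr) →
        unchanged (¬qp ∘ samePair-comm , ¬sr ∘ samePair-comm , ¬qr , ¬ps)
    }

  reverse : TwoSwitch B A q r s p
  reverse = record
    { A-pq = B-qr ; A-rs = flipped B B-ps ; A-qr = B-rs ; A-ps = flipped B B-pq
    ; B-pq = A-qr ; B-rs = flipped A A-ps ; B-qr = A-rs ; B-ps = flipped A A-pq
    ; unchanged = λ (¬qr , ¬sp , ¬rs , ¬qp) →
        sym (unchanged (¬qp ∘ samePair-comm , ¬rs , ¬qr , ¬sp ∘ samePair-comm))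
    }

  untouched-row-p : ∀ {u} → u ≢ q → u ≢ s → Untouched p q r s p u
  untouched-row-p u≢q u≢s =
    ¬samePair (inj₂ u≢q) (inj₁ p≢q) , ¬samePair (inj₁ p≢r) (inj₁ p≢s) ,
    ¬samePair (inj₁ p≢q) (inj₁ p≢r) , ¬samePair (inj₂ u≢s) (inj₁ p≢s)

  row-switched : ∀ u → edge B p u ≡ edge A p (PC.transpose q s u)
  row-switched u with u ≟ q | u ≟ s
  ... | yes refl | _ = trans B-pq (sym A-ps)
  ... | no _ | yes refl rewrite dec-true (u ≟ u) refl = trans B-ps (sym A-pq)
  ... | no u≢q | no u≢s rewrite dec-false (u ≟ s) u≢s = sym (unchanged (untouched-row-p u≢q u≢s))

  degree-at-p : degree A p ≡ degree B p
  degree-at-p = trans (sum-transpose (λ u → 𝟙 (edge A p u)) q s)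
    (sum-cong-≗ (λ u → cong 𝟙 (sym (row-switched u))))

  untouched-row : ∀ {i} j → i ≢ p → i ≢ q → i ≢ r → i ≢ s → edge A i j ≡ edge B i j
  untouched-row j i≢p i≢q i≢r i≢s = unchanged (untouched-outside j i≢p i≢q i≢r i≢s)

switch-degrees : ∀ {m} {A B : GraphOn m} {p q r s} → TwoSwitch A B p q r s → SameDegrees A B
switch-degrees {p = p} {q} {r} {s} sw v with v ≟ p | v ≟ q | v ≟ r | v ≟ s
... | yes refl | _ | _ | _ = degree-at-p sw
... | no _ | yes refl | _ | _ = degree-at-p (swap-ends sw)
... | no _ | no _ | yes refl | _ = degree-at-p (swap-sides sw)
... | no _ | no _ | no _ | yes refl = degree-at-p (swap-ends (swap-sides sw))
... | no v≢p | no v≢q | no v≢r | no v≢s =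
  sum-cong-≗ (λ u → cong 𝟙 (untouched-row sw u v≢p v≢q v≢r v≢s))

record Switchable {m} (A : GraphOn m) (p q r s : Fin m) : Set where
  field
    adj-pq    : edge A p q ≡ true
    adj-rs    : edge A r s ≡ true
    nonadj-qr : edge A q r ≡ false
    nonadj-ps : edge A p s ≡ false
    q≢r       : q ≢ r
    p≢s       : p ≢ s

  p≢q : p ≢ q
  p≢q = adjacent⇒≢ A adj-pq
  r≢s : r ≢ s
  r≢s = adjacent⇒≢ A adj-rs
  p≢r : p ≢ r
  p≢r = separated⇒≢ A (flipped A adj-pq) nonadj-qr
  q≢s : q ≢ s
  q≢s = separated⇒≢ A adj-pq nonadj-ps

¬samePair-diag : ∀ {m} {i x y : Fin m} → x ≢ y → ¬ SamePair i i x y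
¬samePair-diag x≢y (inj₁ (refl , refl)) = x≢y refl
¬samePair-diag x≢y (inj₂ (refl , refl)) = x≢y refl

module _ {m} (A : GraphOn m) {p q r s : Fin m} (sa : Switchable A p q r s) where
  open Switchable sa

  private
    removed? : ∀ i j → Dec (SamePair i j p q ⊎ SamePair i j r s)
    removed? i j = samePair? i j p q ⊎-dec samePair? i j r s
    added? : ∀ i j → Dec (SamePair i j q r ⊎ SamePair i j p s)
    added? i j = samePair? i j q r ⊎-dec samePair? i j p s

    switched : Fin m → Fin m → Bool
    switched i j = if does (removed? i j) then false else if does (added? i j) then true else edge A i j

  switch : GraphOn m
  switch = record { edge = switched ; edge-sym = switched-sym ; edge-irr = switched-irr }
    where
    switched-sym : ∀ i j → switched i j ≡ switched j i
    switched-sym i j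
      rewrite samePair?-sym i j p q | samePair?-sym i j r s | samePair?-sym i j q r | samePair?-sym i j p s
            | edge-sym A i j = refl
    switched-irr : ∀ i → switched i i ≡ false
    switched-irr i
      rewrite dec-false (removed? i i) Sum.[ ¬samePair-diag p≢q , ¬samePair-diag r≢s ]
            | dec-false (added? i i) Sum.[ ¬samePair-diag q≢r , ¬samePair-diag p≢s ] = edge-irr A i

  switch-twoSwitch : TwoSwitch A switch p q r s
  switch-twoSwitch = record
    { A-pq = adj-pq ; A-rs = adj-rs ; A-qr = nonadj-qr ; A-ps = nonadj-ps
    ; B-pq = removed (inj₁ (inj₁ (refl , refl)))
    ; B-rs = removed (inj₂ (inj₁ (refl , refl)))
    ; B-qr = added (Sum.[ ¬samePair (inj₁ (≢-sym p≢q)) (inj₂ (≢-sym p≢r)) , ¬samePair (inj₁ q≢r) (inj₁ q≢s) ])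
                   (inj₁ (inj₁ (refl , refl)))
    ; B-ps = added (Sum.[ ¬samePair (inj₂ (≢-sym q≢s)) (inj₁ p≢q) , ¬samePair (inj₁ p≢r) (inj₁ p≢s) ])
                   (inj₂ (inj₁ (refl , refl)))
    ; unchanged = λ (¬pq , ¬rs , ¬qr , ¬ps) → sym (kept Sum.[ ¬pq , ¬rs ] Sum.[ ¬qr , ¬ps ])
    }
    where
    removed : ∀ {i j} → SamePair i j p q ⊎ SamePair i j r s → switched i j ≡ false
    removed {i} {j} rm rewrite dec-true (removed? i j) rm = refl
    added : ∀ {i j} → ¬ (SamePair i j p q ⊎ SamePair i j r s) → SamePair i j q r ⊎ SamePair i j p s →
      switched i j ≡ true
    added {i} {j} ¬rm ad rewrite dec-false (removed? i j) ¬rm | dec-true (added? i j) ad = refl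
    kept : ∀ {i j} → ¬ (SamePair i j p q ⊎ SamePair i j r s) → ¬ (SamePair i j q r ⊎ SamePair i j p s) →
      switched i j ≡ edge A i j
    kept {i} {j} ¬rm ¬ad rewrite dec-false (removed? i j) ¬rm | dec-false (added? i j) ¬ad = refl

-- Configuration-free switches

Outside : ∀ {m} (p q r s t : Fin m) → Set
Outside p q r s t = t ≢ p × t ≢ q × t ≢ r × t ≢ s

outside? : ∀ {m} (p q r s t : Fin m) → Dec (Outside p q r s t)
outside? p q r s t = ¬? (t ≟ p) ×-dec ¬? (t ≟ q) ×-dec ¬? (t ≟ r) ×-dec ¬? (t ≟ s)

Twins : ∀ {m} → GraphOn m → (p q r s : Fin m) → Set
Twins A p q r s = ∀ t → Outside p q r s t → edge A p t ≡ edge A r t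

Separator : ∀ {m} → GraphOn m → (p q r s t : Fin m) → Set
Separator A p q r s t = Outside p q r s t × edge A p t ≢ edge A r t

twins-or-separator : ∀ {m} (A : GraphOn m) p q r s → Twins A p q r s ⊎ ∃ (Separator A p q r s)
twins-or-separator A p q r s
  with Finₚ.any? (λ t → outside? p q r s t ×-dec ¬? (edge A p t Boolₚ.≟ edge A r t))
... | yes separator = inj₂ separator
... | no ¬separator = inj₁ λ t out →
  decidable-stable (edge A p t Boolₚ.≟ edge A r t) (λ p≁r → ¬separator (t , out , p≁r))

private
  row-transfer : ∀ {m} {A B : GraphOn m} {p q r s} → TwoSwitch A B p q r s → Twins A p q r s →
    ∀ {o} → o ≢ p → o ≢ r → edge A r o ≡ edge B p o
  row-transfer {A = A} {q = q} {s = s} sw twins {o} o≢p o≢r with o ≟ q | o ≟ s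
  ... | yes refl | _ = trans (flipped A A-qr) (sym B-pq) where open TwoSwitch sw
  ... | no _ | yes refl = trans A-rs (sym B-ps) where open TwoSwitch sw
  ... | no o≢q | no o≢s =
    trans (sym (twins o (o≢p , o≢q , o≢r , o≢s))) (TwoSwitch.unchanged sw (untouched-row-p sw o≢q o≢s))

data Position {m} (p r : Fin m) : Fin m → Set where
  at-p      : Position p r p
  at-r      : Position p r r
  elsewhere : ∀ {o} → o ≢ p → o ≢ r → Position p r o

position : ∀ {m} (p r o : Fin m) → Position p r o
position p r o with o ≟ p | o ≟ r
... | yes refl | _ = at-p
... | no _ | yes refl = at-r
... | no o≢p | no o≢r = elsewhere o≢p o≢r

switch-≅ : ∀ {m} {A B : GraphOn m} {p q r s} → TwoSwitch A B p q r s → Twins A p q r s → graph A ≅ graph B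
switch-≅ {A = A} {B} {p} {q} {r} {s} sw twins = Perm.transpose p r , preserved
  where
  open TwoSwitch sw
  τ = PC.transpose p r
  τp = transpose-ˡ p r
  τr = transpose-ʳ p r
  row-transfer′ : ∀ {o} → o ≢ p → o ≢ r → edge A p o ≡ edge B r o
  row-transfer′ o≢p o≢r = row-transfer (swap-sides sw)
    (λ t (t≢r , t≢s , t≢p , t≢q) → sym (twins t (t≢p , t≢q , t≢r , t≢s))) o≢r o≢p
  untouched-pr : Untouched p q r s p r
  untouched-pr = untouched-row-p sw (≢-sym q≢r) r≢s
  preserved : ∀ i j → edge A i j ≡ edge B (τ i) (τ j)
  preserved i j with position p r i | position p r j
  ... | at-p | at-p = trans (edge-irr A p) (sym (edge-irr B _))
  ... | at-r | at-r = trans (edge-irr A r) (sym (edge-irr B _))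
  ... | at-p | at-r rewrite τp | τr = trans (unchanged untouched-pr) (edge-sym B p r)
  ... | at-r | at-p rewrite τp | τr = trans (edge-sym A r p) (unchanged untouched-pr)
  ... | at-p | elsewhere o≢p o≢r rewrite τp | transpose-other o≢p o≢r = row-transfer′ o≢p o≢r
  ... | at-r | elsewhere o≢p o≢r rewrite τr | transpose-other o≢p o≢r = row-transfer sw twins o≢p o≢r
  ... | elsewhere o≢p o≢r | at-p rewrite τp | transpose-other o≢p o≢r =
    trans (edge-sym A _ p) (trans (row-transfer′ o≢p o≢r) (edge-sym B r _))
  ... | elsewhere o≢p o≢r | at-r rewrite τr | transpose-other o≢p o≢r =
    trans (edge-sym A _ r) (trans (row-transfer sw twins o≢p o≢r) (edge-sym B p _))
  ... | elsewhere i≢p i≢r | elsewhere j≢p j≢r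
    rewrite transpose-other i≢p i≢r | transpose-other j≢p j≢r =
    unchanged ( ¬samePair (inj₁ i≢p) (inj₂ j≢p) , ¬samePair (inj₁ i≢r) (inj₂ j≢r)
              , ¬samePair (inj₂ j≢r) (inj₁ i≢r) , ¬samePair (inj₁ i≢p) (inj₂ j≢p))

unique-switch-vertices : ∀ {m} {A B : GraphOn m} {p q r s} → TwoSwitch A B p q r s →
  ∀ {k} {ts : Vec (Fin m) k} → Unique ts → VAll.All (Outside p q r s) ts → Unique (p ∷ q ∷ r ∷ s ∷ ts)
unique-switch-vertices sw ts! outs =
  (p≢q ∷ p≢r ∷ p≢s ∷ VAll.map (≢-sym ∘ proj₁) outs) ∷
  (q≢r ∷ q≢s ∷ VAll.map (≢-sym ∘ proj₁ ∘ proj₂) outs) ∷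
  (r≢s ∷ VAll.map (≢-sym ∘ proj₁ ∘ proj₂ ∘ proj₂) outs) ∷
  VAll.map (≢-sym ∘ proj₂ ∘ proj₂ ∘ proj₂) outs ∷ ts!
  where open TwoSwitch sw

outside-swap : ∀ {m} {p q r s t : Fin m} → Outside p q r s t → Outside r s p q t
outside-swap (t≢p , t≢q , t≢r , t≢s) = t≢r , t≢s , t≢p , t≢q

module _ {m} {A B : GraphOn m} (noConfig : NoConfigurations (graph A)) where

  private
    ¬a : ¬ ContainsConfig (graph A) confA
    ¬a = proj₁ noConfig
    ¬b : ¬ ContainsConfig (graph A) confB
    ¬b = proj₁ (proj₂ noConfig)
    ¬c : ¬ ContainsConfig (graph A) confC
    ¬c = proj₁ (proj₂ (proj₂ noConfig))
    ¬d : ¬ ContainsConfig (graph A) confD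
    ¬d = proj₂ (proj₂ (proj₂ noConfig))

    embedding : ∀ C (v : Vec (Fin m) (k C)) → Unique v →
      All (λ (a , c) → edge A (Vec.lookup v a) (Vec.lookup v c) ≡ true) (edges C) →
      All (λ (a , c) → edge A (Vec.lookup v a) (Vec.lookup v c) ≡ false) (nonedges C) →
      ContainsConfig (graph A) C
    embedding C v v! on-edges on-nonedges = Vec.lookup v , lookup-injective v! , on-edges , on-nonedges

    -- t₁ tells p from r and t₂ tells q from s; together with p q r s they form a configuration.
    separators⇒configuration : ∀ {p q r s t₁ t₂} → TwoSwitch A B p q r s →
      Outside p q r s t₁ → edge A p t₁ ≡ true → edge A r t₁ ≡ false →
      Outside p q r s t₂ → edge A q t₂ ≢ edge A s t₂ → ⊥
    separators⇒configuration {p} {q} {r} {s} {t₁} {t₂} sw out₁ pt₁ rt₁ out₂ q≁s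
      with t₁ ≟ t₂ | edge A q t₂ in qt₂
    ... | yes refl | true = ¬b (embedding confB (p ∷ q ∷ r ∷ s ∷ t₁ ∷ [])
      (unique-switch-vertices sw ([] ∷ []) (out₁ ∷ []))
      (A-pq ∷ A-rs ∷ pt₁ ∷ qt₂ ∷ [])
      (A-qr ∷ A-ps ∷ rt₁ ∷ ¬-not (≢-sym q≁s) ∷ []))
      where open TwoSwitch sw
    ... | yes refl | false = ¬a (embedding confA (r ∷ s ∷ p ∷ q ∷ t₁ ∷ [])
      (unique-switch-vertices (swap-sides sw) ([] ∷ []) (outside-swap out₁ ∷ []))
      (A-rs ∷ A-pq ∷ ¬-not (≢-sym q≁s) ∷ pt₁ ∷ [])
      (flipped A A-ps ∷ flipped A A-qr ∷ rt₁ ∷ qt₂ ∷ []))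
      where open TwoSwitch sw
    ... | no t₁≢t₂ | true = ¬c (embedding confC (p ∷ q ∷ r ∷ s ∷ t₂ ∷ t₁ ∷ [])
      (unique-switch-vertices sw ((≢-sym t₁≢t₂ ∷ []) ∷ [] ∷ []) (out₂ ∷ out₁ ∷ []))
      (A-pq ∷ A-rs ∷ pt₁ ∷ qt₂ ∷ [])
      (A-qr ∷ A-ps ∷ rt₁ ∷ ¬-not (≢-sym q≁s) ∷ []))
      where open TwoSwitch sw
    ... | no t₁≢t₂ | false = ¬d (embedding confD (r ∷ s ∷ p ∷ q ∷ t₁ ∷ t₂ ∷ [])
      (unique-switch-vertices (swap-sides sw) ((t₁≢t₂ ∷ []) ∷ [] ∷ [])
        (outside-swap out₁ ∷ outside-swap out₂ ∷ []))
      (A-rs ∷ A-pq ∷ pt₁ ∷ ¬-not (≢-sym q≁s) ∷ [])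
      (flipped A A-ps ∷ flipped A A-qr ∷ rt₁ ∷ qt₂ ∷ []))
      where open TwoSwitch sw

    two-separators : ∀ {p q r s t₁ t₂} → TwoSwitch A B p q r s →
      Separator A p q r s t₁ → Separator A q p s r t₂ → ⊥
    two-separators {p} {t₁ = t₁} sw (out₁ , p≁r) ((t≢q , t≢p , t≢s , t≢r) , q≁s)
      with edge A p t₁ in pt₁
    ... | true  = separators⇒configuration sw out₁ pt₁ (¬-not (≢-sym p≁r)) (t≢p , t≢q , t≢r , t≢s) q≁s
    ... | false = separators⇒configuration (swap-sides sw) (outside-swap out₁) (¬-not (≢-sym p≁r)) pt₁
                    (t≢r , t≢s , t≢p , t≢q) (≢-sym q≁s)

  noConfigurations⇒switch-≅ : ∀ {p q r s} → TwoSwitch A B p q r s → graph A ≅ graph B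
  noConfigurations⇒switch-≅ {p} {q} {r} {s} sw
    with twins-or-separator A p q r s | twins-or-separator A q p s r
  ... | inj₁ twins | _ = switch-≅ sw twins
  ... | inj₂ _ | inj₁ twins = switch-≅ (swap-ends sw) twins
  ... | inj₂ (_ , sep₁) | inj₂ (_ , sep₂) = ⊥-elim (two-separators sw sep₁ sep₂)

-- Counting arguments

mismatch : ∀ {m} → Fin m → GraphOn m → GraphOn m → ℕ
mismatch w A B = sum (λ y → 𝟙 (edge A w y xor edge B w y))

mismatch-comm : ∀ {m} (w : Fin m) A B → mismatch w A B ≡ mismatch w B A
mismatch-comm w A B = sum-cong-≗ (λ y → cong 𝟙 (xor-comm (edge A w y) (edge B w y)))
  where
  xor-comm : ∀ a b → a xor b ≡ b xor a
  xor-comm true  true  = refl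
  xor-comm true  false = refl
  xor-comm false true  = refl
  xor-comm false false = refl

mismatch-switch : ∀ {m} {X X′ : GraphOn m} {p q r s} → TwoSwitch X X′ p q r s →
  ∀ Y → edge Y p q ≡ false → edge Y p s ≡ true → mismatch p X′ Y + 2 ≡ mismatch p X Y
mismatch-switch {X = X} {X′} {p} {q} {r} {s} sw Y Ypq Yps = begin
  mismatch p X′ Y + 2
    ≡⟨ cong (mismatch p X′ Y +_) (sym (cong₂ _+_ (sum-δ q 1) (sum-δ s 1))) ⟩
  mismatch p X′ Y + (sum (δ q 1) + sum (δ s 1))
    ≡⟨ cong (mismatch p X′ Y +_) (sym (∑-distrib-+ (δ q 1) (δ s 1))) ⟩
  mismatch p X′ Y + sum (λ u → δ q 1 u + δ s 1 u)
    ≡⟨ sym (∑-distrib-+ (λ u → 𝟙 (edge X′ p u xor edge Y p u)) (λ u → δ q 1 u + δ s 1 u)) ⟩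
  sum (λ u → 𝟙 (edge X′ p u xor edge Y p u) + (δ q 1 u + δ s 1 u))
    ≡⟨ sum-cong-≗ repaired ⟩
  mismatch p X Y ∎
  where
  open ≡-Reasoning
  open TwoSwitch sw
  repaired : ∀ u → 𝟙 (edge X′ p u xor edge Y p u) + (δ q 1 u + δ s 1 u) ≡ 𝟙 (edge X p u xor edge Y p u)
  repaired u with u ≟ q | u ≟ s
  ... | yes refl | yes refl = ⊥-elim (q≢s refl)
  ... | yes refl | no _ rewrite B-pq | A-pq | Ypq = refl
  ... | no _ | yes refl rewrite B-ps | A-ps | Yps = refl
  ... | no u≢q | no u≢s rewrite unchanged (untouched-row-p sw u≢q u≢s) = ℕₚ.+-identityʳ _

opposite-mismatch : ∀ {m} (A B : GraphOn m) w → degree A w ≡ degree B w →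
  ∀ {u} → edge A w u ≡ true → edge B w u ≡ false → ∃ λ u′ → edge A w u′ ≡ false × edge B w u′ ≡ true
opposite-mismatch A B w same {u} Awu Bwu
  with Finₚ.any? (λ u′ → (edge A w u′ Boolₚ.≟ false) ×-dec (edge B w u′ Boolₚ.≟ true))
... | yes found = found
... | no none = contradiction (begin
  degree B w + 1                        ≡⟨ cong (degree B w +_) (sym (sum-δ u 1)) ⟩
  degree B w + sum (δ u 1)              ≡⟨ sym (∑-distrib-+ (λ y → 𝟙 (edge B w y)) (δ u 1)) ⟩
  sum (λ y → 𝟙 (edge B w y) + δ u 1 y)  ≤⟨ sum-mono-≤ dominated ⟩
  degree A w                            ≡⟨ same ⟩
  degree B w                            ∎) (ℕₚ.m+1+n≰m (degree B w))
  where
  open ℕₚ.≤-Reasoning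
  dominated : ∀ y → 𝟙 (edge B w y) + δ u 1 y ≤ 𝟙 (edge A w y)
  dominated y with y ≟ u
  ... | yes refl rewrite Awu | Bwu = ℕₚ.≤-refl
  ... | no _ = subst (_≤ _) (sym (ℕₚ.+-identityʳ _)) (𝟙-mono (λ (Bwy , Awy) → none (y , Awy , Bwy)))

module _ {m} (A B : GraphOn m) (same : SameDegrees A B) {k : ℕ} {w x z : Fin m}
  (Awz : edge A w z ≡ true) (Bwz : edge B w z ≡ false) (Awx : edge A w x ≡ false) (Bwx : edge B w x ≡ true)
  (low-x : ∀ y → toℕ y < k → edge A x y ≡ edge B x y) (low-z : ∀ y → toℕ y < k → edge A z y ≡ edge B z y)
  where

  Exchange : Fin m → Set
  Exchange y = k ≤ toℕ y × y ≢ w × y ≢ x × y ≢ z ×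
    (edge A x y ≡ true × edge A z y ≡ false ⊎ edge B z y ≡ true × edge B x y ≡ false)

  private
    exchange? : ∀ y → Dec (Exchange y)
    exchange? y = k ℕₚ.≤? toℕ y ×-dec ¬? (y ≟ w) ×-dec ¬? (y ≟ x) ×-dec ¬? (y ≟ z) ×-dec
      ((edge A x y Boolₚ.≟ true ×-dec edge A z y Boolₚ.≟ false) ⊎-dec
       (edge B z y Boolₚ.≟ true ×-dec edge B x y Boolₚ.≟ false))

    ℓ r : Fin m → ℕ
    ℓ y = 𝟙 (edge A x y) + 𝟙 (edge B z y)
    r y = 𝟙 (edge A z y) + 𝟙 (edge B x y)

    w≢x : w ≢ x
    w≢x = adjacent⇒≢ B Bwx
    w≢z : w ≢ z
    w≢z = adjacent⇒≢ A Awz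
    x≢z : x ≢ z
    x≢z = ≢-sym (separated⇒≢ A Awz Awx)

    sum-ℓ≡sum-r : sum ℓ ≡ sum r
    sum-ℓ≡sum-r = begin
      sum ℓ                         ≡⟨ ∑-distrib-+ (λ y → 𝟙 (edge A x y)) (λ y → 𝟙 (edge B z y)) ⟩
      degree A x + degree B z       ≡⟨ cong₂ _+_ (same x) (sym (same z)) ⟩
      degree B x + degree A z       ≡⟨ ℕₚ.+-comm (degree B x) (degree A z) ⟩
      degree A z + degree B x       ≡⟨ ∑-distrib-+ (λ y → 𝟙 (edge A z y)) (λ y → 𝟙 (edge B x y)) ⟨
      sum r                         ∎
      where open ≡-Reasoning

    -- The columns x and z only match up after exchanging them; at w there is slack 2.
    dominated : (∀ y → ¬ Exchange y) → ∀ y → ℓ (PC.transpose x z y) + δ w 2 y ≤ r y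
    dominated none y with position x z y
    ... | at-p rewrite transpose-ˡ x z | dec-false (x ≟ w) (≢-sym w≢x)
                     | edge-irr B z | edge-irr B x | edge-sym A x z = ℕₚ.≤-reflexive (ℕₚ.+-identityʳ _)
    ... | at-r rewrite transpose-ʳ x z | dec-false (z ≟ w) (≢-sym w≢z)
                     | edge-irr A x | edge-irr A z | edge-sym B z x = ℕₚ.≤-reflexive (ℕₚ.+-identityʳ _)
    ... | elsewhere y≢x y≢z rewrite transpose-other y≢x y≢z with y ≟ w
    ...   | yes refl rewrite flipped A Awx | flipped B Bwz | flipped A Awz | flipped B Bwx = ℕₚ.≤-refl
    ...   | no y≢w rewrite ℕₚ.+-identityʳ (ℓ y) with toℕ y ℕₚ.<? k
    ...     | yes y<k rewrite low-x y y<k | low-z y y<k =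
              ℕₚ.≤-reflexive (ℕₚ.+-comm (𝟙 (edge B x y)) (𝟙 (edge B z y)))
    ...     | no y≮k = ℕₚ.+-mono-≤
              (𝟙-mono (λ (Axy , Azy) → none y (ℕₚ.≮⇒≥ y≮k , y≢w , y≢x , y≢z , inj₁ (Axy , Azy))))
              (𝟙-mono (λ (Bzy , Bxy) → none y (ℕₚ.≮⇒≥ y≮k , y≢w , y≢x , y≢z , inj₂ (Bzy , Bxy))))

  exchange : ∃ Exchange
  exchange with Finₚ.any? exchange?
  ... | yes found = found
  ... | no none = contradiction (begin
    sum ℓ + 2                                        ≡⟨ cong₂ _+_ (sum-transpose ℓ x z) (sym (sum-δ w 2)) ⟩
    sum (ℓ ∘ PC.transpose x z) + sum (δ w 2)         ≡⟨ ∑-distrib-+ (ℓ ∘ PC.transpose x z) (δ w 2) ⟨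
    sum (λ y → ℓ (PC.transpose x z y) + δ w 2 y)     ≤⟨ sum-mono-≤ (dominated (λ y e → none (y , e))) ⟩
    sum r                                            ≡⟨ sum-ℓ≡sum-r ⟨
    sum ℓ                                            ∎) (ℕₚ.m+1+n≰m (sum ℓ))
    where open ℕₚ.≤-Reasoning

-- Transforming one graph into another

+2⇒< : ∀ {a b} → a + 2 ≡ b → a < b
+2⇒< {a} refl = ℕₚ.m<m+n a (s≤s z≤n)

Agree : ∀ {m} → ℕ → GraphOn m → GraphOn m → Set
Agree k A B = ∀ i j → toℕ i < k → edge A i j ≡ edge B i j

record Aligned {m} (k : ℕ) (A B : GraphOn m) : Set where
  field
    noConfig    : NoConfigurations (graph A)
    sameDegrees : SameDegrees A B
    agree       : Agree k A B

IsoFromAgreement : ℕ → ℕ → Set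
IsoFromAgreement m k = ∀ (A B : GraphOn m) → Aligned k A B → graph A ≅ graph B

below⇒≢ : ∀ {m k} {i v : Fin m} → toℕ i < k → k ≤ toℕ v → i ≢ v
below⇒≢ i<k k≤v refl = ℕₚ.<-irrefl refl (ℕₚ.<-≤-trans i<k k≤v)

switch-agree : ∀ {m} {A B : GraphOn m} {p q r s k} → TwoSwitch A B p q r s →
  k ≤ toℕ p → k ≤ toℕ q → k ≤ toℕ r → k ≤ toℕ s → Agree k A B
switch-agree sw k≤p k≤q k≤r k≤s i j i<k =
  untouched-row sw j (below⇒≢ i<k k≤p) (below⇒≢ i<k k≤q) (below⇒≢ i<k k≤r) (below⇒≢ i<k k≤s)

module _ {m k} {A B : GraphOn m} (al : Aligned k A B) {p q r s : Fin m}
  (k≤p : k ≤ toℕ p) (k≤q : k ≤ toℕ q) (k≤r : k ≤ toℕ r) (k≤s : k ≤ toℕ s) where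
  open Aligned al

  switch-left : ∀ {A′} → TwoSwitch A A′ p q r s → Aligned k A′ B
  switch-left {A′} sw = record
    { noConfig    =
        ≅⇒noConfigurations (graph A) (graph A′) (noConfigurations⇒switch-≅ noConfig sw) noConfig
    ; sameDegrees = λ v → trans (sym (switch-degrees sw v)) (sameDegrees v)
    ; agree       = λ i j i<k → trans (sym (switch-agree sw k≤p k≤q k≤r k≤s i j i<k)) (agree i j i<k)
    }

  switch-right : ∀ {B′} → TwoSwitch B B′ p q r s → Aligned k A B′
  switch-right sw = record
    { noConfig    = noConfig
    ; sameDegrees = λ v → trans (sameDegrees v) (switch-degrees sw v)
    ; agree       = λ i j i<k → trans (agree i j i<k) (switch-agree sw k≤p k≤q k≤r k≤s i j i<k)
    }

agree-all : ∀ {m} (A B : GraphOn m) → Agree m A B → graph A ≅ graph B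
agree-all A B agree = ≅-pointwise A B (λ i j → agree i j (Finₚ.toℕ<n i))

module _ {m k} (k<m : k < m) (IH : IsoFromAgreement m (suc k)) where

  private
    w : Fin m
    w = fromℕ< k<m

    k≤w : k ≤ toℕ w
    k≤w = ℕₚ.≤-reflexive (sym (Finₚ.toℕ-fromℕ< k<m))

    agree-column : ∀ (A B : GraphOn m) → Agree k A B → ∀ x y → toℕ y < k → edge A x y ≡ edge B x y
    agree-column A B agree x y y<k = trans (edge-sym A x y) (trans (agree y x y<k) (edge-sym B y x))

    agree-row-w : ∀ (A B : GraphOn m) → Agree k A B → (∀ y → edge A w y ≡ edge B w y) → Agree (suc k) A B
    agree-row-w A B agree row-w i j i<1+k with ℕₚ.m<1+n⇒m<n∨m≡n i<1+k
    ... | inj₁ i<k = agree i j i<k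
    ... | inj₂ i≡k rewrite Finₚ.toℕ-injective (trans i≡k (sym (Finₚ.toℕ-fromℕ< k<m))) = row-w j

    above : ∀ (A B : GraphOn m) {x b} → Agree k A B → edge A x w ≡ b → edge B x w ≡ not b → k ≤ toℕ x
    above A B agree Axw Bxw = ℕₚ.≮⇒≥ λ x<k →
      Boolₚ.not-¬ refl (trans (sym Axw) (trans (agree _ w x<k) Bxw))

    Smaller : ℕ → Set
    Smaller c = ∀ A B → mismatch w A B < c → Aligned k A B → graph A ≅ graph B

    repair : ∀ (A B : GraphOn m) {x z} → Smaller (mismatch w A B) → Aligned k A B →
      edge A w z ≡ true → edge B w z ≡ false → edge A w x ≡ false → edge B w x ≡ true → graph A ≅ graph B
    repair A B {x} {z} smaller al Awz Bwz Awx Bwx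
      with exchange A B sameDegrees Awz Bwz Awx Bwx (agree-column A B agree x) (agree-column A B agree z)
      where open Aligned al
    ... | y , k≤y , y≢w , y≢x , y≢z , inj₁ (Axy , Azy) =
      ≅-trans (graph A) (graph A′) (graph B) (noConfigurations⇒switch-≅ noConfig sw)
        (smaller A′ B (+2⇒< (mismatch-switch sw B Bwz Bwx)) (switch-left al k≤w k≤z k≤y k≤x sw))
      where
      open Aligned al
      k≤x = above A B agree (flipped A Awx) (flipped B Bwx)
      k≤z = above A B agree (flipped A Awz) (flipped B Bwz)
      sa : Switchable A w z y x
      sa = record { adj-pq = Awz ; adj-rs = flipped A Axy ; nonadj-qr = Azy ; nonadj-ps = Awx
                  ; q≢r = ≢-sym y≢z ; p≢s = adjacent⇒≢ B Bwx }
      A′ = switch A sa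
      sw = switch-twoSwitch A sa
    ... | y , k≤y , y≢w , y≢x , y≢z , inj₂ (Bzy , Bxy) =
      ≅-trans (graph A) (graph B′) (graph B) A≅B′
        (noConfigurations⇒switch-≅ (≅⇒noConfigurations (graph A) (graph B′) A≅B′ noConfig) (reverse sw))
      where
      open Aligned al
      k≤x = above A B agree (flipped A Awx) (flipped B Bwx)
      k≤z = above A B agree (flipped A Awz) (flipped B Bwz)
      sb : Switchable B w x y z
      sb = record { adj-pq = Bwx ; adj-rs = flipped B Bzy ; nonadj-qr = Bxy ; nonadj-ps = Bwz
                  ; q≢r = ≢-sym y≢x ; p≢s = adjacent⇒≢ A Awz }
      B′ = switch B sb
      sw = switch-twoSwitch B sb
      fewer : mismatch w A B′ < mismatch w A B
      fewer = +2⇒< (trans (cong (_+ 2) (mismatch-comm w A B′))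
                          (trans (mismatch-switch sw A Awx Awz) (mismatch-comm w B A)))
      A≅B′ : graph A ≅ graph B′
      A≅B′ = smaller A B′ fewer (switch-right al k≤w k≤x k≤y k≤z sw)

  agreement-step : IsoFromAgreement m k
  agreement-step A B = <-rec Goal go _ A B refl
    where
    Goal : ℕ → Set
    Goal c = ∀ A B → mismatch w A B ≡ c → Aligned k A B → graph A ≅ graph B
    go : ∀ c → (∀ {c′} → c′ < c → Goal c′) → Goal c
    go _ rec A B refl al with Finₚ.any? (λ y → ¬? (edge A w y Boolₚ.≟ edge B w y))
    ... | no rows-equal = IH A B record
      { noConfig    = Aligned.noConfig al
      ; sameDegrees = Aligned.sameDegrees al
      ; agree       = agree-row-w A B (Aligned.agree al) λ y →
          decidable-stable (edge A w y Boolₚ.≟ edge B w y) (λ A≢B → rows-equal (y , A≢B))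
      }
    ... | yes (y₀ , A≢B) with edge A w y₀ in Awy₀
    ...   | true with opposite-mismatch A B w (Aligned.sameDegrees al w) Awy₀ (¬-not (≢-sym A≢B))
    ...     | x , Awx , Bwx = repair A B smaller al Awy₀ (¬-not (≢-sym A≢B)) Awx Bwx
      where smaller = λ A′ B′ fewer → rec fewer A′ B′ refl
    go _ rec A B refl al | yes (y₀ , A≢B) | false
      with opposite-mismatch B A w (sym (Aligned.sameDegrees al w)) (¬-not (≢-sym A≢B)) Awy₀
    ...     | z , Bwz , Awz = repair A B smaller al Awz Bwz Awy₀ (¬-not (≢-sym A≢B))
      where smaller = λ A′ B′ fewer → rec fewer A′ B′ refl

isoFromAgreement : ∀ {m} d k → d + k ≡ m → IsoFromAgreement m k
isoFromAgreement zero    k refl A B al = agree-all A B (Aligned.agree al)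
isoFromAgreement (suc d) k d+k≡m =
  agreement-step k<m (isoFromAgreement d (suc k) (trans (ℕₚ.+-suc d k) d+k≡m))
  where
  k<m = subst (k <_) d+k≡m (ℕₚ.m<n+m k (s≤s z≤n))

sameDegrees⇒≅ : ∀ {m} (A B : GraphOn m) → NoConfigurations (graph A) → SameDegrees A B → graph A ≅ graph B
sameDegrees⇒≅ {m} A B noConfig same =
  isoFromAgreement m 0 (ℕₚ.+-identityʳ m) A B
    (record { noConfig = noConfig ; sameDegrees = same ; agree = λ _ _ () })

-- Degree sequences

lookup-map-tabulate : ∀ {A B : Set} {k} (f : B → A) (g : Fin k → B) (i : Fin k) →
  lookup (map f (tabulate g)) (cast (sym (trans (Listₚ.length-map f (tabulate g)) (Listₚ.length-tabulate g))) i)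
    ≡ f (g i)
lookup-map-tabulate {k = suc k} f g zero    = refl
lookup-map-tabulate {k = suc k} f g (suc i) = lookup-map-tabulate f (λ j → g (suc j)) i

length-degSeq : ∀ G → length (degSeq G) ≡ n G
length-degSeq G = trans (Listₚ.length-map (deg G) (allFin (n G))) (Listₚ.length-tabulate (λ u → u))

sameDegSeq⇒permutation : ∀ G H → SameDegSeq G H →
  Σ (Permutation (n G) (n H)) λ π → ∀ v → deg G v ≡ deg H (π ⟨$⟩ʳ v)
sameDegSeq⇒permutation G H same = π , λ v → begin
  deg G v                           ≡⟨ lookup-map-tabulate (deg G) (λ u → u) v ⟨
  lookup (degSeq G) (ιG v)          ≡⟨ Permₛₚ.onIndices-lookup (setoid ℕ) same′ (ιG v) ⟩
  lookup (degSeq H) (σ ⟨$⟩ʳ ιG v)   ≡⟨ cong (lookup (degSeq H)) (Finₚ.cast-involutive (sym eH) eH _) ⟨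
  lookup (degSeq H) (ιH (π ⟨$⟩ʳ v)) ≡⟨ lookup-map-tabulate (deg H) (λ u → u) (π ⟨$⟩ʳ v) ⟩
  deg H (π ⟨$⟩ʳ v)                  ∎
  where
  open ≡-Reasoning
  eG = length-degSeq G
  eH = length-degSeq H
  ιG = cast (sym eG)
  ιH = cast (sym eH)
  same′ = ↭⇒↭ₛ same
  σ = Permₛ.onIndices same′
  π = Perm.cast-id (sym eG) ∘ₚ σ ∘ₚ Perm.cast-id eH

noConfigurations⇒hereditaryUnigraph : ∀ G → NoConfigurations G → HereditaryUnigraph G
noConfigurations⇒hereditaryUnigraph G noConfig k f f-inj H same
  with sameDegSeq⇒permutation (induced G k f) H same
... | π , deg-π =
  ≅-trans G′ (graph H′) H (sameDegrees⇒≅ (onVertices G′) H′ noConfig′ same-degrees) (relabel-≅ H π)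
  where
  G′ = induced G k f
  H′ = relabel H π
  noConfig′ = contains⇒noConfigurations G G′ (contains-induced G k f f-inj) noConfig
  same-degrees : SameDegrees (onVertices G′) H′
  same-degrees v = trans (sym (deg≡degree G′ v))
    (trans (deg-π v) (trans (deg≡degree H (π ⟨$⟩ʳ v)) (sym (degree-relabel H π v))))

unique? : ∀ {m k} (v : Vec (Fin m) k) → Dec (Unique v)
unique? = allPairs? (λ x y → ¬? (x ≟ y))

anyVec? : ∀ {m} k {P : Vec (Fin m) k → Set} → (∀ v → Dec (P v)) → Dec (∃ P)
anyVec? zero    P? = map′ ([] ,_) (λ { ([] , p) → p }) (P? [])
anyVec? (suc k) P? = map′ (λ (x , v , p) → x ∷ v , p) (λ { (x ∷ v , p) → x , v , p })
  (Finₚ.any? λ x → anyVec? k (λ v → P? (x ∷ v)))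

InducedAt : (G H : Graph) → Vec (Fin (n G)) (n H) → Set
InducedAt G H v = Unique v × (∀ i j → adj H i j ≡ adj G (Vec.lookup v i) (Vec.lookup v j))

inducedAt? : ∀ G H v → Dec (InducedAt G H v)
inducedAt? G H v = unique? v ×-dec Finₚ.all? λ i → Finₚ.all? λ j → adj H i j Boolₚ.≟ _

containsInduced? : (G H : Graph) → Dec (ContainsInduced G H)
containsInduced? G H = map′
  (λ (v , v! , v-adj) → Vec.lookup v , lookup-injective v! , v-adj)
  (λ (f , f-inj , f-adj) → Vec.tabulate f , Uniqueₚ.tabulate⁺ f-inj ,
    λ i j → subst₂′ (f-adj i j) (Vecₚ.lookup∘tabulate f i) (Vecₚ.lookup∘tabulate f j))
  (anyVec? (n H) (inducedAt? G H))
  where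
  subst₂′ : ∀ {b x x′ y y′} → b ≡ adj G x y → x′ ≡ x → y′ ≡ y → b ≡ adj G x′ y′
  subst₂′ e refl refl = e

ConfigAt : (G : Graph) (C : Configuration) → Vec (Fin (n G)) (k C) → Set
ConfigAt G C v = Unique v ×
  All (λ (a , c) → adj G (Vec.lookup v a) (Vec.lookup v c) ≡ true) (edges C) ×
  All (λ (a , c) → adj G (Vec.lookup v a) (Vec.lookup v c) ≡ false) (nonedges C)

configAt? : ∀ G C v → Dec (ConfigAt G C v)
configAt? G C v =
  unique? v ×-dec All.all? (λ _ → _ Boolₚ.≟ true) _ ×-dec All.all? (λ _ → _ Boolₚ.≟ false) _

configAt : ∀ G C (v : Vec (Fin (n G)) (k C)) → {True (configAt? G C v)} → ContainsConfig G C
configAt G C v {ok} with toWitness ok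
... | v! , on-edges , on-nonedges = Vec.lookup v , lookup-injective v! , on-edges , on-nonedges

-- Completions of a configuration

Entry : ℕ → Set
Entry k = Fin k × Fin k × Bool

Holds : (G : Graph) {k : ℕ} → (Fin k → Fin (n G)) → Entry k → Set
Holds G f (a , c , b) = adj G (f a) (f c) ≡ b

prescribed : (C : Configuration) → List (Entry (k C))
prescribed C = map (λ (a , c) → a , c , true) (edges C) ++ map (λ (a , c) → a , c , false) (nonedges C)

containsConfig⇒holds : ∀ G C ((f , _) : ContainsConfig G C) → All (Holds G f) (prescribed C)
containsConfig⇒holds G C (f , _ , on-edges , on-nonedges) =
  Allₚ.++⁺ (Allₚ.map⁺ on-edges) (Allₚ.map⁺ on-nonedges)

Forces : ∀ {k} → Entry k → Fin k → Fin k → Bool → Set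
Forces (x , y , v) a c b = v ≡ b × ((x ≡ a × y ≡ c) ⊎ (x ≡ c × y ≡ a))

forces? : ∀ {k} e (a c : Fin k) b → Dec (Forces e a c b)
forces? (x , y , v) a c b = v Boolₚ.≟ b ×-dec ((x ≟ a ×-dec y ≟ c) ⊎-dec (x ≟ c ×-dec y ≟ a))

forced-adj : ∀ G {k es a c b} {f : Fin k → Fin (n G)} →
  All (Holds G f) es → Any (λ e → Forces e a c b) es → adj G (f a) (f c) ≡ b
forced-adj G (h ∷ _)  (here (refl , inj₁ (refl , refl))) = h
forced-adj G (h ∷ _)  (here (refl , inj₂ (refl , refl))) = trans (adj-sym G _ _) h
forced-adj G (_ ∷ hs) (there forced) = forced-adj G hs forced

-- A case split on the adjacency of pairs of configuration vertices; each leaf names a member of 𝓕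
-- and the vertices that induce it once the adjacencies fixed along the branch are known.
data SplitTree (k : ℕ) : Set where
  found : (i : Fin (length 𝓕)) → Vec (Fin k) (n (lookup 𝓕 i)) → SplitTree k
  split : Fin k → Fin k → (ifAdjacent ifNonadjacent : SplitTree k) → SplitTree k

Settles : ∀ {k} → List (Entry k) → SplitTree k → Set
Settles es (found i v) = Unique v × ∀ x y →
  x ≡ y ⊎ Any (λ e → Forces e (Vec.lookup v x) (Vec.lookup v y) (adj (lookup 𝓕 i) x y)) es
Settles es (split a c t u) = Settles ((a , c , true) ∷ es) t × Settles ((a , c , false) ∷ es) u

settles? : ∀ {k} es (t : SplitTree k) → Dec (Settles es t)
settles? es (found i v) = unique? v ×-dec Finₚ.all? λ x → Finₚ.all? λ y →
  x ≟ y ⊎-dec Any.any? (λ e → forces? e _ _ _) es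
settles? es (split a c t u) = settles? _ t ×-dec settles? _ u

settles⇒¬free : ∀ G {k es} {f : Fin k → Fin (n G)} → Injective _≡_ _≡_ f → All (Holds G f) es →
  (t : SplitTree k) → Settles es t → ¬ Free 𝓕 G
settles⇒¬free G {f = f} f-inj holds (split a c t u) (settles-t , settles-u)
  with adj G (f a) (f c) in fa~fc
... | true  = settles⇒¬free G f-inj (fa~fc ∷ holds) t settles-t
... | false = settles⇒¬free G f-inj (fa~fc ∷ holds) u settles-u
settles⇒¬free G {f = f} f-inj holds (found i v) (v! , forced) free =
  All.lookup free (∈-lookup i) (f ∘ Vec.lookup v , lookup-injective v! ∘ f-inj , same-adj)
  where
  F = lookup 𝓕 i
  same-adj : ∀ x y → adj F x y ≡ adj G (f (Vec.lookup v x)) (f (Vec.lookup v y))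
  same-adj x y with forced x y
  ... | inj₁ refl = trans (adj-irr F x) (sym (adj-irr G _))
  ... | inj₂ fxy  = sym (forced-adj G holds fxy)

free⇒¬containsConfig : ∀ C (t : SplitTree (k C)) → {True (settles? (prescribed C) t)} →
  ∀ G → Free 𝓕 G → ¬ ContainsConfig G C
free⇒¬containsConfig C t {ok} G free G⊇C@(_ , f-inj , _) =
  settles⇒¬free G f-inj (containsConfig⇒holds G C G⊇C) t (toWitness ok) free

-- Forbidden graphs that are not unigraphs

contains⇒degSeq : ∀ G F ((f , _) : ContainsInduced G F) → degSeq (induced G (n F) f) ≡ degSeq F
contains⇒degSeq G F (f , _ , f-adj) = Listₚ.map-cong
  (λ v → cong sumList (Listₚ.map-cong (λ u → cong (if_then 1 else 0) (sym (f-adj v u))) (allFin (n F))))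
  (allFin (n F))

record DegreeTwin (F : Graph) : Set where
  field
    twin        : Graph
    same-degSeq : degSeq F ≡ degSeq twin
    {size}      : ℕ
    part        : Vec (Fin (n F)) size
    part-unique : Unique part
    part-absent : ¬ ContainsInduced twin (induced F size (Vec.lookup part))

degreeTwin : ∀ {F} (H : Graph) → degSeq F ≡ degSeq H → ∀ {k} (v : Vec (Fin (n F)) k) →
  {True (unique? v)} → {False (containsInduced? H (induced F k (Vec.lookup v)))} → DegreeTwin F
degreeTwin H same v {v!} {absent} = record
  { twin = H ; same-degSeq = same
  ; part = v ; part-unique = toWitness v! ; part-absent = toWitnessFalse absent }

degreeTwin⇒forbidden : ∀ {F} → DegreeTwin F → ∀ G → HereditaryUnigraph G → ¬ ContainsInduced G F
degreeTwin⇒forbidden {F} T G hu G⊇F@(f , f-inj , f-adj) =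
  part-absent (contains-trans twin G′ P (≅⇒contains G′ twin G′≅twin)
    (contains-trans G′ F P (id , id , f-adj)
      (contains-induced F size (Vec.lookup part) (lookup-injective part-unique))))
  where
  open DegreeTwin T
  P = induced F size (Vec.lookup part)
  G′ = induced G (n F) f
  G′≅twin : G′ ≅ twin
  G′≅twin = hu (n F) f f-inj twin (↭-reflexive (trans (contains⇒degSeq G F G⊇F) same-degSeq))

-- Certificates

#P5 #house #K2+K3 #K23 #pan4 #copan4 #twoP3 #K2K1joinK2K1 : Fin (length 𝓕)
#K2+P4 #twoK1joinP4 #K2+C4 #twoK1join2K2 #X1 #X2 #co-X1 #co-X2 : Fin (length 𝓕)
#P5 = # 0
#house = # 1
#K2+K3 = # 2
#K23 = # 3
#pan4 = # 4
#copan4 = # 5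
#twoP3 = # 6
#K2K1joinK2K1 = # 7
#K2+P4 = # 8
#twoK1joinP4 = # 9
#K2+C4 = # 10
#twoK1join2K2 = # 11
#X1 = # 12
#X2 = # 13
#co-X1 = # 14
#co-X2 = # 15

treeA : SplitTree 5
treeA =
  split 0F 2F
    (split 1F 3F
      (found #K23 (1F ∷ 2F ∷ 0F ∷ 3F ∷ 4F ∷ []))
      (found #pan4 (2F ∷ 0F ∷ 1F ∷ 4F ∷ 3F ∷ [])))
    (split 1F 3F
      (found #pan4 (1F ∷ 3F ∷ 2F ∷ 4F ∷ 0F ∷ []))
      (found #P5 (0F ∷ 1F ∷ 4F ∷ 2F ∷ 3F ∷ [])))

treeB : SplitTree 5
treeB =
  split 0F 2F
    (split 1F 3F
      (found #house (0F ∷ 1F ∷ 3F ∷ 2F ∷ 4F ∷ []))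
      (found #copan4 (3F ∷ 1F ∷ 2F ∷ 4F ∷ 0F ∷ [])))
    (split 1F 3F
      (found #copan4 (2F ∷ 0F ∷ 3F ∷ 4F ∷ 1F ∷ []))
      (found #K2+K3 (2F ∷ 3F ∷ 0F ∷ 1F ∷ 4F ∷ [])))

treeC : SplitTree 6
treeC =
  split 0F 2F
    (split 0F 4F
      (split 1F 3F
        (split 1F 5F
          (split 2F 4F
            (split 3F 5F
              (split 4F 5F
                (found #K2K1joinK2K1 (0F ∷ 4F ∷ 3F ∷ 1F ∷ 5F ∷ 2F ∷ []))
                (found #house (0F ∷ 2F ∷ 3F ∷ 5F ∷ 4F ∷ [])))
              (found #house (0F ∷ 1F ∷ 3F ∷ 2F ∷ 5F ∷ [])))
            (found #house (0F ∷ 1F ∷ 3F ∷ 2F ∷ 4F ∷ [])))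
          (split 3F 5F
            (found #K23 (0F ∷ 3F ∷ 1F ∷ 2F ∷ 5F ∷ []))
            (found #pan4 (0F ∷ 1F ∷ 3F ∷ 2F ∷ 5F ∷ []))))
        (split 1F 5F
          (split 3F 5F
            (found #house (0F ∷ 5F ∷ 3F ∷ 2F ∷ 1F ∷ []))
            (found #copan4 (3F ∷ 1F ∷ 2F ∷ 5F ∷ 0F ∷ [])))
          (split 2F 4F
            (split 3F 5F
              (found #pan4 (0F ∷ 2F ∷ 3F ∷ 5F ∷ 1F ∷ []))
              (split 4F 5F
                (found #X2 (0F ∷ 1F ∷ 2F ∷ 3F ∷ 5F ∷ 4F ∷ []))
                (found #X1 (0F ∷ 1F ∷ 2F ∷ 3F ∷ 5F ∷ 4F ∷ []))))
            (found #copan4 (3F ∷ 1F ∷ 2F ∷ 4F ∷ 0F ∷ [])))))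
      (split 1F 3F
        (split 2F 4F
          (found #K23 (1F ∷ 2F ∷ 0F ∷ 3F ∷ 4F ∷ []))
          (found #pan4 (1F ∷ 0F ∷ 2F ∷ 3F ∷ 4F ∷ [])))
        (split 2F 4F
          (found #pan4 (2F ∷ 0F ∷ 1F ∷ 4F ∷ 3F ∷ []))
          (found #P5 (3F ∷ 2F ∷ 0F ∷ 1F ∷ 4F ∷ [])))))
    (split 0F 4F
      (split 1F 3F
        (split 2F 4F
          (found #house (1F ∷ 4F ∷ 2F ∷ 3F ∷ 0F ∷ []))
          (found #copan4 (2F ∷ 0F ∷ 3F ∷ 4F ∷ 1F ∷ [])))
        (split 2F 4F
          (found #copan4 (3F ∷ 0F ∷ 2F ∷ 1F ∷ 4F ∷ []))
          (found #K2+K3 (2F ∷ 3F ∷ 0F ∷ 1F ∷ 4F ∷ []))))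
      (split 1F 3F
        (split 1F 5F
          (split 2F 4F
            (found #pan4 (1F ∷ 3F ∷ 2F ∷ 4F ∷ 0F ∷ []))
            (split 3F 5F
              (split 4F 5F
                (found #X2 (1F ∷ 0F ∷ 3F ∷ 2F ∷ 4F ∷ 5F ∷ []))
                (found #X1 (1F ∷ 0F ∷ 3F ∷ 2F ∷ 4F ∷ 5F ∷ [])))
              (found #copan4 (2F ∷ 0F ∷ 3F ∷ 5F ∷ 1F ∷ []))))
          (split 3F 5F
            (found #pan4 (3F ∷ 1F ∷ 0F ∷ 5F ∷ 2F ∷ []))
            (found #P5 (2F ∷ 3F ∷ 1F ∷ 0F ∷ 5F ∷ []))))
        (split 1F 5F
          (split 3F 5F
            (found #copan4 (2F ∷ 0F ∷ 3F ∷ 1F ∷ 5F ∷ []))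
            (found #K2+K3 (2F ∷ 3F ∷ 0F ∷ 1F ∷ 5F ∷ [])))
          (split 2F 4F
            (found #P5 (0F ∷ 1F ∷ 4F ∷ 2F ∷ 3F ∷ []))
            (split 3F 5F
              (found #P5 (1F ∷ 0F ∷ 5F ∷ 3F ∷ 2F ∷ []))
              (split 4F 5F
                (found #K2+C4 (2F ∷ 3F ∷ 0F ∷ 1F ∷ 4F ∷ 5F ∷ []))
                (found #K2+P4 (2F ∷ 3F ∷ 4F ∷ 1F ∷ 0F ∷ 5F ∷ []))))))))

treeD : SplitTree 6
treeD =
  split 0F 2F
    (split 0F 5F
      (split 1F 3F
        (split 1F 4F
          (split 2F 5F
            (split 3F 4F
              (split 4F 5F
                (found #twoK1joinP4 (1F ∷ 2F ∷ 0F ∷ 5F ∷ 4F ∷ 3F ∷ []))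
                (found #twoK1join2K2 (1F ∷ 2F ∷ 0F ∷ 5F ∷ 3F ∷ 4F ∷ [])))
              (found #K23 (1F ∷ 2F ∷ 0F ∷ 3F ∷ 4F ∷ [])))
            (found #house (0F ∷ 1F ∷ 3F ∷ 2F ∷ 5F ∷ [])))
          (split 3F 4F
            (found #house (2F ∷ 3F ∷ 1F ∷ 0F ∷ 4F ∷ []))
            (found #pan4 (2F ∷ 0F ∷ 1F ∷ 3F ∷ 4F ∷ []))))
        (split 1F 4F
          (split 3F 4F
            (found #house (2F ∷ 4F ∷ 1F ∷ 0F ∷ 3F ∷ []))
            (found #pan4 (2F ∷ 0F ∷ 1F ∷ 4F ∷ 3F ∷ [])))
          (split 2F 5F
            (split 3F 4F
              (found #copan4 (1F ∷ 3F ∷ 0F ∷ 4F ∷ 2F ∷ []))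
              (split 4F 5F
                (found #co-X1 (3F ∷ 0F ∷ 1F ∷ 2F ∷ 5F ∷ 4F ∷ []))
                (found #co-X2 (3F ∷ 0F ∷ 1F ∷ 2F ∷ 5F ∷ 4F ∷ []))))
            (found #copan4 (3F ∷ 1F ∷ 2F ∷ 5F ∷ 0F ∷ [])))))
      (split 1F 3F
        (split 2F 5F
          (found #K23 (1F ∷ 2F ∷ 0F ∷ 3F ∷ 5F ∷ []))
          (found #pan4 (1F ∷ 0F ∷ 2F ∷ 3F ∷ 5F ∷ [])))
        (split 2F 5F
          (found #pan4 (2F ∷ 0F ∷ 1F ∷ 5F ∷ 3F ∷ []))
          (found #P5 (3F ∷ 2F ∷ 0F ∷ 1F ∷ 5F ∷ [])))))
    (split 0F 5F
      (split 1F 3F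
        (split 2F 5F
          (found #house (1F ∷ 5F ∷ 2F ∷ 3F ∷ 0F ∷ []))
          (found #copan4 (2F ∷ 0F ∷ 3F ∷ 5F ∷ 1F ∷ [])))
        (split 2F 5F
          (found #copan4 (3F ∷ 0F ∷ 2F ∷ 1F ∷ 5F ∷ []))
          (found #K2+K3 (2F ∷ 3F ∷ 0F ∷ 1F ∷ 5F ∷ []))))
      (split 1F 3F
        (split 1F 4F
          (split 2F 5F
            (found #pan4 (1F ∷ 3F ∷ 2F ∷ 5F ∷ 0F ∷ []))
            (split 3F 4F
              (split 4F 5F
                (found #co-X1 (0F ∷ 3F ∷ 2F ∷ 1F ∷ 4F ∷ 5F ∷ []))
                (found #co-X2 (0F ∷ 3F ∷ 2F ∷ 1F ∷ 4F ∷ 5F ∷ [])))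
              (found #pan4 (1F ∷ 3F ∷ 2F ∷ 4F ∷ 0F ∷ []))))
          (split 3F 4F
            (found #copan4 (0F ∷ 2F ∷ 1F ∷ 4F ∷ 3F ∷ []))
            (found #P5 (0F ∷ 1F ∷ 3F ∷ 2F ∷ 4F ∷ []))))
        (split 1F 4F
          (split 3F 4F
            (found #copan4 (0F ∷ 2F ∷ 1F ∷ 3F ∷ 4F ∷ []))
            (found #P5 (0F ∷ 1F ∷ 4F ∷ 2F ∷ 3F ∷ [])))
          (split 2F 5F
            (found #P5 (0F ∷ 1F ∷ 5F ∷ 2F ∷ 3F ∷ []))
            (split 3F 4F
              (found #K2+K3 (0F ∷ 1F ∷ 2F ∷ 3F ∷ 4F ∷ []))
              (split 4F 5F
                (found #P5 (0F ∷ 1F ∷ 5F ∷ 4F ∷ 2F ∷ []))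
                (found #twoP3 (0F ∷ 1F ∷ 5F ∷ 3F ∷ 2F ∷ 4F ∷ []))))))))

degreeTwins : All DegreeTwin 𝓕
degreeTwins =
  degreeTwin (fromEdges 5 ((0F , 4F) ∷ (1F , 2F) ∷ (1F , 3F) ∷ (2F , 3F) ∷ []))
    refl (0F ∷ 1F ∷ 2F ∷ []) ∷
  degreeTwin (fromEdges 5 ((0F , 2F) ∷ (0F , 3F) ∷ (0F , 4F) ∷ (1F , 2F) ∷ (1F , 3F) ∷ (1F , 4F) ∷ []))
    refl (0F ∷ 1F ∷ 4F ∷ []) ∷
  degreeTwin (fromEdges 5 ((0F , 4F) ∷ (1F , 3F) ∷ (2F , 3F) ∷ (2F , 4F) ∷ []))
    refl (2F ∷ 3F ∷ 4F ∷ []) ∷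
  degreeTwin (fromEdges 5 ((0F , 1F) ∷ (0F , 3F) ∷ (0F , 4F) ∷ (1F , 2F) ∷ (1F , 4F) ∷ (2F , 3F) ∷ []))
    refl (2F ∷ 3F ∷ 4F ∷ []) ∷
  degreeTwin (fromEdges 5 ((0F , 1F) ∷ (0F , 2F) ∷ (0F , 3F) ∷ (1F , 4F) ∷ (2F , 3F) ∷ []))
    refl (1F ∷ 3F ∷ 4F ∷ []) ∷
  degreeTwin (fromEdges 5 ((0F , 4F) ∷ (1F , 3F) ∷ (1F , 4F) ∷ (2F , 3F) ∷ (2F , 4F) ∷ []))
    refl (1F ∷ 3F ∷ 4F ∷ []) ∷
  degreeTwin (fromEdges 6 ((0F , 4F) ∷ (1F , 4F) ∷ (1F , 5F) ∷ (2F , 3F) ∷ []))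
    refl (0F ∷ 2F ∷ 3F ∷ 5F ∷ []) ∷
  degreeTwin (fromEdges 6 ((0F , 2F) ∷ (0F , 3F) ∷ (0F , 4F) ∷ (0F , 5F) ∷ (1F , 2F) ∷ (1F , 3F) ∷ (1F , 4F) ∷ (1F , 5F) ∷ (2F , 4F) ∷ (3F , 4F) ∷ (3F , 5F) ∷ []))
    refl (0F ∷ 1F ∷ 3F ∷ 4F ∷ []) ∷
  degreeTwin (fromEdges 6 ((0F , 4F) ∷ (1F , 4F) ∷ (2F , 3F) ∷ (3F , 5F) ∷ []))
    refl (2F ∷ 3F ∷ 4F ∷ 5F ∷ []) ∷
  degreeTwin (fromEdges 6 ((0F , 1F) ∷ (0F , 3F) ∷ (0F , 4F) ∷ (0F , 5F) ∷ (1F , 3F) ∷ (1F , 4F) ∷ (1F , 5F) ∷ (2F , 3F) ∷ (2F , 4F) ∷ (2F , 5F) ∷ (3F , 4F) ∷ []))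
    refl (2F ∷ 3F ∷ 4F ∷ 5F ∷ []) ∷
  degreeTwin (fromEdges 6 ((0F , 5F) ∷ (1F , 5F) ∷ (2F , 3F) ∷ (2F , 4F) ∷ (3F , 4F) ∷ []))
    refl (2F ∷ 3F ∷ 4F ∷ 5F ∷ []) ∷
  degreeTwin (fromEdges 6 ((0F , 1F) ∷ (0F , 3F) ∷ (0F , 4F) ∷ (0F , 5F) ∷ (1F , 3F) ∷ (1F , 4F) ∷ (1F , 5F) ∷ (2F , 3F) ∷ (2F , 4F) ∷ (2F , 5F) ∷ []))
    refl (2F ∷ 3F ∷ 4F ∷ 5F ∷ []) ∷
  degreeTwin (fromEdges 6 ((0F , 2F) ∷ (0F , 3F) ∷ (0F , 4F) ∷ (0F , 5F) ∷ (1F , 2F) ∷ (1F , 5F) ∷ (2F , 5F) ∷ []))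
    refl (0F ∷ 1F ∷ 2F ∷ 4F ∷ 5F ∷ []) ∷
  degreeTwin (fromEdges 6 ((0F , 1F) ∷ (0F , 2F) ∷ (0F , 4F) ∷ (0F , 5F) ∷ (1F , 5F) ∷ (2F , 4F) ∷ (2F , 5F) ∷ (3F , 5F) ∷ []))
    refl (0F ∷ 1F ∷ 2F ∷ 4F ∷ 5F ∷ []) ∷
  degreeTwin (fromEdges 6 ((0F , 1F) ∷ (1F , 3F) ∷ (1F , 4F) ∷ (2F , 3F) ∷ (2F , 4F) ∷ (3F , 4F) ∷ (3F , 5F) ∷ (4F , 5F) ∷ []))
    refl (0F ∷ 1F ∷ 2F ∷ 4F ∷ 5F ∷ []) ∷
  degreeTwin (fromEdges 6 ((0F , 3F) ∷ (1F , 3F) ∷ (1F , 4F) ∷ (1F , 5F) ∷ (2F , 3F) ∷ (2F , 4F) ∷ (3F , 4F) ∷ []))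
    refl (0F ∷ 1F ∷ 2F ∷ 4F ∷ 5F ∷ []) ∷
  []

module _ (F : Graph) where
  containsA : (v : Vec (Fin (n F)) 5) → {True (configAt? F confA v)} → ¬ NoConfigurations F
  containsA v {ok} (¬a , _) = ¬a (configAt F confA v {ok})
  containsB : (v : Vec (Fin (n F)) 5) → {True (configAt? F confB v)} → ¬ NoConfigurations F
  containsB v {ok} (_ , ¬b , _) = ¬b (configAt F confB v {ok})
  containsC : (v : Vec (Fin (n F)) 6) → {True (configAt? F confC v)} → ¬ NoConfigurations F
  containsC v {ok} (_ , _ , ¬c , _) = ¬c (configAt F confC v {ok})
  containsD : (v : Vec (Fin (n F)) 6) → {True (configAt? F confD v)} → ¬ NoConfigurations F
  containsD v {ok} (_ , _ , _ , ¬d) = ¬d (configAt F confD v {ok})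

configured : All (λ F → ¬ NoConfigurations F) 𝓕
configured =
  containsA P5             (0F ∷ 1F ∷ 3F ∷ 4F ∷ 2F ∷ []) ∷
  containsB house          (0F ∷ 1F ∷ 3F ∷ 2F ∷ 4F ∷ []) ∷
  containsB K2+K3          (2F ∷ 3F ∷ 0F ∷ 1F ∷ 4F ∷ []) ∷
  containsA K23            (2F ∷ 0F ∷ 1F ∷ 3F ∷ 4F ∷ []) ∷
  containsA pan4           (1F ∷ 2F ∷ 0F ∷ 4F ∷ 3F ∷ []) ∷
  containsB copan4         (1F ∷ 4F ∷ 0F ∷ 2F ∷ 3F ∷ []) ∷
  containsD twoP3          (0F ∷ 1F ∷ 4F ∷ 3F ∷ 5F ∷ 2F ∷ []) ∷
  containsC K2K1joinK2K1   (0F ∷ 3F ∷ 5F ∷ 2F ∷ 1F ∷ 4F ∷ []) ∷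
  containsC K2+P4          (3F ∷ 4F ∷ 0F ∷ 1F ∷ 5F ∷ 2F ∷ []) ∷
  containsD twoK1joinP4    (2F ∷ 0F ∷ 1F ∷ 5F ∷ 4F ∷ 3F ∷ []) ∷
  containsC K2+C4          (2F ∷ 3F ∷ 0F ∷ 1F ∷ 4F ∷ 5F ∷ []) ∷
  containsD twoK1join2K2   (2F ∷ 0F ∷ 1F ∷ 4F ∷ 5F ∷ 3F ∷ []) ∷
  containsC X1             (0F ∷ 1F ∷ 2F ∷ 3F ∷ 5F ∷ 4F ∷ []) ∷
  containsC X2             (0F ∷ 1F ∷ 2F ∷ 3F ∷ 5F ∷ 4F ∷ []) ∷
  containsD (complement X1) (0F ∷ 3F ∷ 2F ∷ 1F ∷ 4F ∷ 5F ∷ []) ∷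
  containsD (complement X2) (0F ∷ 3F ∷ 2F ∷ 1F ∷ 4F ∷ 5F ∷ []) ∷
  []

hereditaryUnigraph⇒free : ∀ G → HereditaryUnigraph G → Free 𝓕 G
hereditaryUnigraph⇒free G hu = All.map (λ twin → degreeTwin⇒forbidden twin G hu) degreeTwins

noConfigurations⇒free : ∀ G → NoConfigurations G → Free 𝓕 G
noConfigurations⇒free G noConfig = All.map (λ {F} F-configured G⊇F →
  F-configured (contains⇒noConfigurations G F G⊇F noConfig)) configured

free⇒noConfigurations : ∀ G → Free 𝓕 G → NoConfigurations G
free⇒noConfigurations G free =
  free⇒¬containsConfig confA treeA G free , free⇒¬containsConfig confB treeB G free ,
  free⇒¬containsConfig confC treeC G free , free⇒¬containsConfig confD treeD G free

theorem4p2 : ∀ (G : Graph) →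
    (HereditaryUnigraph G ⇔ NoConfigurations G) × (NoConfigurations G ⇔ Free 𝓕 G)
theorem4p2 G =
  mk⇔ (free⇒noConfigurations G ∘ hereditaryUnigraph⇒free G) (noConfigurations⇒hereditaryUnigraph G) ,
  mk⇔ (noConfigurations⇒free G) (free⇒noConfigurations G)
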